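{- Let $n,r,s,p,n_1,\dots,n_p$ be positive integers with $n\ge 2$, $s\ge r$, $p\ge 3$ and $n_p\ge\cdots\ge n_1\ge 1$. For every graph $H$: (i) $\xi(K_n\odot H)=n$ if $n\ne 2$, and $\xi(K_2\odot H)=\mathrm{n}(H)+1$; (ii) $\xi(K_{r,s}\odot H)=r\,\mathrm{n}(H)+s$; (iii) $\xi(K_2(r,s)\odot H)=r\,\mathrm{n}(H)+s$; (iv) $\xi(K_{n_1,\dots,n_p}\odot H)=\sum_{i=1}^p n_i$; (v) $\xi(W_n\odot H)=n$ if $n\ge 4$; (vi) $\xi(Q_n\odot H)=2^{n-1}(\mathrm{n}(H)+1)$; (vii) $\xi(P_n\odot H)=\lfloor n/2\rfloor\,\mathrm{n}(H)+\lceil n/2\rceil$; (viii) for $n\ge 3$, $\xi(C_n\odot H)=n$ if $n$ is odd, and $\xi(C_n\odot H)=\frac{n(\mathrm{n}(H)+1)}{2}$ if $n$ is even.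
   Context: All graphs are finite, simple and undirected; $\mathrm{n}(H)$ denotes the order of $H$. For a connected graph $\Gamma$, a set $S\subseteq V(\Gamma)$ is a distance-equalizer set if for every two distinct $u,v\in V(\Gamma)\setminus S$ there is $w\in S$ with $d_\Gamma(w,u)=d_\Gamma(w,v)$; $\xi(\Gamma)$ is the minimum cardinality of a distance-equalizer set of $\Gamma$. For a graph $G$ with $V(G)=\{v_1,\dots,v_k\}$, the corona product $G\odot H$ is obtained from $G$ and $k$ pairwise disjoint copies $H_1,\dots,H_k$ of $H$ by joining $v_i$ to every vertex of $H_i$. $K_n$, $P_n$, $C_n$, $W_n$ denote the complete graph, path, cycle and wheel of order $n$ (so $W_n$ is $K_1$ joined to $C_{n-1}$); $K_{r,s}$ is the complete bipartite graph with parts of sizes $r,s$; $K_{n_1,\dots,n_p}$ is the complete $p$-partite graph with parts of sizes $n_1,\dots,n_p$; $Q_n$ is the $n$-dimensional hypercube; $K_2(r,s)$ denotes the bistar (double star: a tree with two adjacent central vertices, every other vertex being a leaf adjacent to one of them) whose two bipartition classes have cardinalities $r$ and $s$. -}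

module Defs where

open import Data.Nat using (ℕ; zero; suc; _+_; _*_; _∸_; _≤_; _≡ᵇ_; _<ᵇ_; _^_)
open import Data.Nat.DivMod using (_/_; _%_)
open import Data.Bool using (Bool; true; false; not; _∧_; _∨_; if_then_else_)
open import Data.Fin using (Fin; toℕ; splitAt; remQuot)
open import Data.Fin.Subset using (Subset; _∈_; _∉_; ∣_∣)
open import Data.Sum using (_⊎_; inj₁; inj₂)
open import Data.Product using (Σ; ∃; _×_; _,_)
open import Data.Unit using (⊤)
open import Data.Vec using (Vec; []; _∷_)
open import Relation.Binary.PropositionalEquality using (_≡_; _≢_)

record Graph : Set where
  field
    order : ℕ
    adj   : Fin order → Fin order → Bool
open Graph public

IsSimple : Graph → Set
IsSimple G = (∀ u v → adj G u v ≡ adj G v u) × (∀ u → adj G u u ≡ false)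

Edge : (G : Graph) → Fin (order G) → Fin (order G) → Set
Edge G u v = adj G u v ≡ true

data Walk (G : Graph) : Fin (order G) → Fin (order G) → ℕ → Set where
  here : ∀ {u} → Walk G u u 0
  step : ∀ {u v w k} → Edge G u v → Walk G v w k → Walk G u w (suc k)

Dist : (G : Graph) → Fin (order G) → Fin (order G) → ℕ → Set
Dist G u v k = Walk G u v k × (∀ j → Walk G u v j → k ≤ j)

IsDistEqualizer : (G : Graph) → Subset (order G) → Set
IsDistEqualizer G S =
  ∀ u v → u ∉ S → v ∉ S → u ≢ v →
    Σ (Fin (order G)) λ w → w ∈ S × ∃ λ k → Dist G w u k × Dist G w v k

XiIs : Graph → ℕ → Set
XiIs G k =
  (Σ (Subset (order G)) λ S → IsDistEqualizer G S × ∣ S ∣ ≡ k)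
  × (∀ S → IsDistEqualizer G S → k ≤ ∣ S ∣)

-- Corona product G ⊙ H.  Vertices: Fin (k + k * m); the first k are the
-- vertices of G, vertex (i , a) of Fin k × Fin m is vertex a of copy H_i.

finEq : ∀ {n} → Fin n → Fin n → Bool
finEq i j = toℕ i ≡ᵇ toℕ j

corona : Graph → Graph → Graph
corona G H = record { order = k + k * m ; adj = a }
  where
  k = order G
  m = order H
  dec : Fin (k + k * m) → Fin k ⊎ (Fin k × Fin m)
  dec x with splitAt k x
  ... | inj₁ i = inj₁ i
  ... | inj₂ y = inj₂ (remQuot {k} m y)
  a' : Fin k ⊎ (Fin k × Fin m) → Fin k ⊎ (Fin k × Fin m) → Bool
  a' (inj₁ i)       (inj₁ j)       = adj G i j
  a' (inj₁ i)       (inj₂ (j , _)) = finEq i j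
  a' (inj₂ (i , _)) (inj₁ j)       = finEq i j
  a' (inj₂ (i , x)) (inj₂ (j , y)) = finEq i j ∧ adj H x y
  a : Fin (k + k * m) → Fin (k + k * m) → Bool
  a x y = a' (dec x) (dec y)

_⊙_ : Graph → Graph → Graph
G ⊙ H = corona G H

fromℕRel : (n : ℕ) → (ℕ → ℕ → Bool) → Graph
fromℕRel n R = record { order = n ; adj = λ i j → R (toℕ i) (toℕ j) }

absDiff : ℕ → ℕ → ℕ
absDiff a b = (a ∸ b) + (b ∸ a)

Kn : ℕ → Graph
Kn n = fromℕRel n (λ a b → not (a ≡ᵇ b))

Pn : ℕ → Graph
Pn n = fromℕRel n (λ a b → absDiff a b ≡ᵇ 1)

cycRel : ℕ → ℕ → ℕ → Bool
cycRel m a b = (absDiff a b ≡ᵇ 1) ∨ (absDiff a b ≡ᵇ (m ∸ 1))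

Cn : ℕ → Graph
Cn n = fromℕRel n (cycRel n)

-- wheel W_n: vertex 0 is the hub, vertices 1..n-1 form C_{n-1}
Wn : ℕ → Graph
Wn n = fromℕRel n R
  where
  R : ℕ → ℕ → Bool
  R zero    zero    = false
  R zero    (suc _) = true
  R (suc _) zero    = true
  R (suc a) (suc b) = cycRel (n ∸ 1) a b

Krs : ℕ → ℕ → Graph
Krs r s = fromℕRel (r + s) (λ a b → not ((a <ᵇ r) ≡ᵇB (b <ᵇ r)))
  where
  _≡ᵇB_ : Bool → Bool → Bool
  true  ≡ᵇB y = y
  false ≡ᵇB y = not y

-- bistar K_2(r,s) (r,s ≥ 1): bipartition classes A = {0..r-1}, B = {r..r+s-1};
-- centres 0 ∈ A and r ∈ B are adjacent; 0 is adjacent to every vertex of B,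
-- r is adjacent to every vertex of A; no other edges.
bistarRel : ℕ → ℕ → ℕ → Bool
bistarRel r a b =
  ((a <ᵇ r) ∧ not (b <ᵇ r) ∧ ((a ≡ᵇ 0) ∨ (b ≡ᵇ r)))
  ∨ ((b <ᵇ r) ∧ not (a <ᵇ r) ∧ ((b ≡ᵇ 0) ∨ (a ≡ᵇ r)))

Bistar : ℕ → ℕ → Graph
Bistar r s = fromℕRel (r + s) (bistarRel r)

-- complete multipartite K_{n_1,...,n_p}: the parts are consecutive blocks
-- of sizes n_1, ..., n_p
sumV : ∀ {p} → Vec ℕ p → ℕ
sumV []       = 0
sumV (x ∷ xs) = x + sumV xs

partOf : ∀ {p} → Vec ℕ p → ℕ → ℕ
partOf []       a = 0
partOf (x ∷ xs) a = if a <ᵇ x then 0 else suc (partOf xs (a ∸ x))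

Kmulti : ∀ {p} → Vec ℕ p → Graph
Kmulti ns = fromℕRel (sumV ns) (λ a b → not (partOf ns a ≡ᵇ partOf ns b))

-- hypercube Q_n: vertices 0..2^n-1, adjacent iff binary expansions
-- (n bits) differ in exactly one bit
hamming : ℕ → ℕ → ℕ → ℕ
hamming zero    a b = 0
hamming (suc n) a b =
  (if (a % 2) ≡ᵇ (b % 2) then 0 else 1) + hamming n (a / 2) (b / 2)

Qn : ℕ → Graph
Qn n = fromℕRel (2 ^ n) (λ a b → hamming n a b ≡ᵇ 1)

-- In G ⊙ H every vertex x lies in the block {v_i} ∪ H_i of exactly one vertex i = root x of G, and for x and y
-- in different blocks d(x, y) = depth x + d_G(root x, root y) + depth y, where depth is 0 on v_i and 1 on H_i.
-- So no vertex outside the block of i sees v_i and a vertex of H_i at the same distance: every distance-equalizer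
-- meets every block, and ξ(G ⊙ H) ≥ n(G).
--
-- If any two vertices of G have a third vertex at equal distance from both (complete and complete multipartite
-- graphs, wheels, odd cycles), the n(G) vertices of G already form a distance-equalizer.
--
-- If G is connected and bipartite with colour classes of sizes r ≤ s (complete bipartite graphs, bistars, K₂,
-- paths, even cycles, hypercubes), two vertices at the same depth in blocks of different colours are seen at
-- distances of different parity from outside their blocks, and at different distances from inside. So the vertices
-- of the copies missed by an equalizer share one colour, every block of the other colour lies in the equalizer,
-- and ξ ≥ r·n(H) + s; the vertices of G in the larger class together with the copies over the smaller class
-- attain this bound.

module Submission where

open import Defs
open import Data.Nat using (ℕ; _+_; _*_; _∸_; _^_; _≤_; _/_; _%_)
open import Data.Fin using (Fin) renaming (_≤_ to _≤ᶠ_)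
open import Data.Vec using (Vec; lookup)
open import Data.Product using (_×_)
open import Relation.Binary.PropositionalEquality using (_≡_; _≢_)

open import Data.Bool using (Bool; true; false; not; T; if_then_else_; _xor_; _∧_; _∨_)
open import Data.Bool.Properties using (xor-comm; ∨-comm; ∨-zeroʳ)
open import Data.Empty using (⊥; ⊥-elim)
open import Data.Fin using (zero; suc; toℕ; fromℕ<; splitAt; remQuot; quotRem; combine; _↑ˡ_; _↑ʳ_; join)
import Data.Fin.Properties as Fin
open import Data.Fin.Subset using (Subset; _∈_; _∉_; ∣_∣)
open import Data.Fin.Subset.Properties using (_∈?_)
open import Data.Nat using (zero; suc; _<_; z≤n; s≤s; NonZero; _≡ᵇ_; _<ᵇ_; _<?_; _≟_; _⊓_; ∣_-_∣; parity; ⌊_/2⌋; ⌈_/2⌉)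
open import Data.Nat.DivMod
open import Data.Nat.Properties
open import Data.Nat.Solver using (module +-*-Solver)
open import Algebra.Properties.Semiring.Sum +-*-semiring using (sum; sum-cong-≗; ∑-distrib-+; *-distribʳ-sum)
open import Data.Parity.Base as ℙ using (Parity; 0ℙ; 1ℙ; _⁻¹)
import Data.Parity.Properties as ℙ
open import Algebra.Properties.CommutativeSemigroup ℙ.+-commutativeSemigroup using (interchange)
open import Data.Product using (∃; ∃₂; ∃-syntax; _,_; proj₁; proj₂)
open import Data.Sum as Sum using (_⊎_; inj₁; inj₂; [_,_]′)
open import Data.Vec using ([]; _∷_; tabulate)
open import Data.Vec.Properties using ([]=⇒lookup; lookup⇒[]=; lookup∘tabulate)
open import Function using (id; _∘_; const)
open import Relation.Binary.Definitions using (tri<; tri≈; tri>)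
open import Relation.Binary.PropositionalEquality
open import Relation.Nullary using (¬_; Dec; yes; no; does; ¬?; _×-dec_)
open import Relation.Nullary.Decidable using (dec-true; decidable-stable)

least-solution : {P : ℕ → Set} → (∀ n → Dec (P n)) → ∀ {l} → P l → ∃[ k ] P k × (∀ j → P j → k ≤ j)
least-solution P? p with P? 0
... | yes p₀ = 0 , p₀ , λ _ _ → z≤n
least-solution P? {zero}  p | no ¬p₀ = ⊥-elim (¬p₀ p)
least-solution P? {suc l} p | no ¬p₀ with least-solution (λ n → P? (suc n)) p
... | k , pk , least = suc k , pk , λ where
  zero    p₀ → ⊥-elim (¬p₀ p₀)
  (suc j) pj → s≤s (least j pj)

T⇒≡true : ∀ {x} → T x → x ≡ true
T⇒≡true {true} _ = refl

∧-true⇒ˡ : ∀ {p q} → (p ∧ q) ≡ true → p ≡ true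
∧-true⇒ˡ {true} _ = refl

≡ᵇ-true⇒≡ : ∀ {a b} → (a ≡ᵇ b) ≡ true → a ≡ b
≡ᵇ-true⇒≡ {a} {b} eq = ≡ᵇ⇒≡ a b (subst T (sym eq) _)

≡ᵇ-refl : ∀ n → (n ≡ᵇ n) ≡ true
≡ᵇ-refl n = T⇒≡true (≡⇒≡ᵇ n n refl)

≡ᵇ-comm : ∀ a b → (a ≡ᵇ b) ≡ (b ≡ᵇ a)
≡ᵇ-comm zero    zero    = refl
≡ᵇ-comm zero    (suc b) = refl
≡ᵇ-comm (suc a) zero    = refl
≡ᵇ-comm (suc a) (suc b) = ≡ᵇ-comm a b

≢⇒not≡ᵇ : ∀ {a b} → a ≢ b → not (a ≡ᵇ b) ≡ true
≢⇒not≡ᵇ {a} {b} a≢b with a ≡ᵇ b in eq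
... | true  = ⊥-elim (a≢b (≡ᵇ-true⇒≡ eq))
... | false = refl

<⇒<ᵇ≡true : ∀ {a b} → a < b → (a <ᵇ b) ≡ true
<⇒<ᵇ≡true a<b = T⇒≡true (<⇒<ᵇ a<b)

≥⇒<ᵇ≡false : ∀ {a b} → b ≤ a → (a <ᵇ b) ≡ false
≥⇒<ᵇ≡false {a} {b} b≤a with a <ᵇ b in eq
... | false = refl
... | true  = ⊥-elim (<⇒≱ (<ᵇ⇒< a b (subst T (sym eq) _)) b≤a)

finEq⇒≡ : ∀ {n} {i j : Fin n} → finEq i j ≡ true → i ≡ j
finEq⇒≡ eq = Fin.toℕ-injective (≡ᵇ-true⇒≡ eq)

finEq-refl : ∀ {n} (i : Fin n) → finEq i i ≡ true
finEq-refl i = ≡ᵇ-refl (toℕ i)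

parity-suc : ∀ n → parity (suc n) ≡ parity n ⁻¹
parity-suc n = sym (ℙ.⁻¹-selfInverse (ℙ.suc-homo-⁻¹ n))

≢⇒≡⁻¹ : ∀ {p q : Parity} → p ≢ q → p ≡ q ⁻¹
≢⇒≡⁻¹ {0ℙ} {0ℙ} p≢q = ⊥-elim (p≢q refl)
≢⇒≡⁻¹ {0ℙ} {1ℙ} _   = refl
≢⇒≡⁻¹ {1ℙ} {0ℙ} _   = refl
≢⇒≡⁻¹ {1ℙ} {1ℙ} p≢q = ⊥-elim (p≢q refl)

n%2≡0⇒even : ∀ n → n % 2 ≡ 0 → parity n ≡ 0ℙ
n%2≡0⇒even zero          _  = refl
n%2≡0⇒even (suc (suc n)) eq = n%2≡0⇒even n eq

n%2≡1⇒odd : ∀ n → n % 2 ≡ 1 → parity n ≡ 1ℙ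
n%2≡1⇒odd (suc zero)    _  = refl
n%2≡1⇒odd (suc (suc n)) eq = n%2≡1⇒odd n eq

⌈n/2⌉≡⌊n/2⌋ : ∀ n → parity n ≡ 0ℙ → ⌈ n /2⌉ ≡ ⌊ n /2⌋
⌈n/2⌉≡⌊n/2⌋ zero          _    = refl
⌈n/2⌉≡⌊n/2⌋ (suc (suc n)) even = cong suc (⌈n/2⌉≡⌊n/2⌋ n even)

⌈n/2⌉≡1+⌊n/2⌋ : ∀ n → parity n ≡ 1ℙ → ⌈ n /2⌉ ≡ suc ⌊ n /2⌋
⌈n/2⌉≡1+⌊n/2⌋ (suc zero)    _   = refl
⌈n/2⌉≡1+⌊n/2⌋ (suc (suc n)) odd = cong suc (⌈n/2⌉≡1+⌊n/2⌋ n odd)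

⌊n/2⌋+⌊n/2⌋≡n : ∀ n → parity n ≡ 0ℙ → ⌊ n /2⌋ + ⌊ n /2⌋ ≡ n
⌊n/2⌋+⌊n/2⌋≡n n even = trans (cong (⌊ n /2⌋ +_) (sym (⌈n/2⌉≡⌊n/2⌋ n even))) (⌊n/2⌋+⌈n/2⌉≡n n)

even-halves : ∀ D → parity D ≡ 0ℙ → 1 ≤ D → ∃[ h ] 1 ≤ h × h + h ≡ D
even-halves D even 1≤D = ⌊ D /2⌋ , n≢0⇒n>0 h≢0 , ⌊n/2⌋+⌊n/2⌋≡n D even
  where
  h≢0 : ⌊ D /2⌋ ≢ 0
  h≢0 h≡0 = <⇒≢ 1≤D (sym (trans (sym (⌊n/2⌋+⌊n/2⌋≡n D even)) (cong (λ h → h + h) h≡0)))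

n/2≡⌊n/2⌋ : ∀ n → n / 2 ≡ ⌊ n /2⌋
n/2≡⌊n/2⌋ zero          = refl
n/2≡⌊n/2⌋ (suc zero)    = refl
n/2≡⌊n/2⌋ (suc (suc n)) = trans (m/n≡1+[m∸n]/n {suc (suc n)} {2} (s≤s (s≤s z≤n))) (cong suc (n/2≡⌊n/2⌋ n))

[n+1]/2≡⌈n/2⌉ : ∀ n → (n + 1) / 2 ≡ ⌈ n /2⌉
[n+1]/2≡⌈n/2⌉ n = trans (cong (_/ 2) (+-comm n 1)) (n/2≡⌊n/2⌋ (suc n))

[m%n+k]%n≡[m+k]%n : ∀ m k n .{{_ : NonZero n}} → (m % n + k) % n ≡ (m + k) % n
[m%n+k]%n≡[m+k]%n m k n = begin
  (m % n + k) % n           ≡⟨ %-distribˡ-+ (m % n) k n ⟩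
  (m % n % n + k % n) % n   ≡⟨ cong (λ z → (z + k % n) % n) (m%n%n≡m%n m n) ⟩
  (m % n + k % n) % n       ≡⟨ %-distribˡ-+ m k n ⟨
  (m + k) % n               ∎
  where open ≡-Reasoning

r*m+s≤r+s*m : ∀ {r s m} → r ≤ s → 1 ≤ m → r * m + s ≤ r + s * m
r*m+s≤r+s*m {r} {s} {suc m} r≤s _ with m≤n⇒∃[o]m+o≡n r≤s
... | t , refl = ≤-trans (m≤m+n _ (t * m)) (≤-reflexive (solve 3 (λ r t m →
      (r :* (con 1 :+ m) :+ (r :+ t)) :+ t :* m := r :+ (r :+ t) :* (con 1 :+ m)) refl r t m))
  where open +-*-Solver

-- Walks and distances

SymmetricAdj : Graph → Set
SymmetricAdj G = ∀ u v → adj G u v ≡ adj G v u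

ProperColouring : (G : Graph) → (Fin (order G) → Parity) → Set
ProperColouring G col = ∀ u v → Edge G u v → col v ≡ col u ⁻¹

Equidistant : (G : Graph) → Fin (order G) → Fin (order G) → Set
Equidistant G i j = ∃₂ λ l d → l ≢ i × l ≢ j × Dist G l i d × Dist G l j d

EquidistantPairs : Graph → Set
EquidistantPairs G = ∀ i j → i ≢ j → Equidistant G i j

equidistant-sym : ∀ {G i j} → Equidistant G i j → Equidistant G j i
equidistant-sym (l , d , l≢i , l≢j , δᵢ , δⱼ) = l , d , l≢j , l≢i , δⱼ , δᵢ

module _ {G : Graph} where
  private variable
    u v w : Fin (order G)
    d e j l : ℕ

  _++ʷ_ : Walk G u v j → Walk G v w l → Walk G u w (j + l)
  here     ++ʷ q = q
  step e p ++ʷ q = step e (p ++ʷ q)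

  _∷ʳʷ_ : Walk G u v j → Edge G v w → Walk G u w (suc j)
  here       ∷ʳʷ e = step e here
  step e′ p ∷ʳʷ e = step e′ (p ∷ʳʷ e)

  splitWalk : ∀ a {b} → Walk G u w (a + b) → ∃[ v ] Walk G u v a × Walk G v w b
  splitWalk zero    p          = _ , here , p
  splitWalk (suc a) (step e p) with splitWalk a p
  ... | v , p₁ , p₂ = v , step e p₁ , p₂

  walk0⇒≡ : Walk G u v 0 → u ≡ v
  walk0⇒≡ here = refl

  reverse : SymmetricAdj G → Walk G u v j → Walk G v u j
  reverse sym-adj here                    = here
  reverse sym-adj (step {u = u} {v = x} e p) = reverse sym-adj p ∷ʳʷ trans (sym-adj x u) e

  walk? : ∀ j (u v : Fin (order G)) → Dec (Walk G u v j)
  walk? zero u v with u Fin.≟ v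
  ... | yes refl = yes here
  ... | no u≢v   = no (λ p → u≢v (walk0⇒≡ p))
  walk? (suc j) u v with Fin.any? (λ x → edge? x ×-dec walk? j x v)
    where
    edge? : ∀ x → Dec (Edge G u x)
    edge? x with adj G u x
    ... | true  = yes refl
    ... | false = no λ ()
  ... | yes (x , e , p) = yes (step e p)
  ... | no ∄x           = no λ where (step e p) → ∄x (_ , e , p)

  walk-potential : (f : Fin (order G) → ℕ) → (∀ x y → Edge G x y → f y ≤ suc (f x)) →
                   Walk G u v j → f v ≤ f u + j
  walk-potential f lip here = ≤-reflexive (sym (+-identityʳ _))
  walk-potential {u = u} f lip (step {v = x} {k = j} e p) = begin
    _            ≤⟨ walk-potential f lip p ⟩
    f x + j      ≤⟨ +-monoˡ-≤ j (lip u x e) ⟩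
    suc (f u) + j ≡⟨ sym (+-suc (f u) j) ⟩
    f u + suc j  ∎
    where open ≤-Reasoning

  walk-parity : ∀ {col} → ProperColouring G col → Walk G u v j → col v ≡ parity j ℙ.+ col u
  walk-parity proper here = refl
  walk-parity {u = u} {col = col} proper (step {v = x} {k = j} e p) = begin
    _                        ≡⟨ walk-parity proper p ⟩
    parity j ℙ.+ col x       ≡⟨ cong (parity j ℙ.+_) (proper u x e) ⟩
    parity j ℙ.+ col u ⁻¹    ≡⟨ +-⁻¹-swap (parity j) (col u) ⟩
    parity j ⁻¹ ℙ.+ col u    ≡⟨ cong (ℙ._+ col u) (parity-suc j) ⟨
    parity (suc j) ℙ.+ col u ∎
    where
    open ≡-Reasoning
    +-⁻¹-swap : ∀ p q → p ℙ.+ q ⁻¹ ≡ p ⁻¹ ℙ.+ q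
    +-⁻¹-swap 0ℙ q = refl
    +-⁻¹-swap 1ℙ q = ℙ.⁻¹-involutive q

  dist-unique : Dist G u v d → Dist G u v e → d ≡ e
  dist-unique (p , p-least) (q , q-least) = ≤-antisym (p-least _ q) (q-least _ p)

  walk⇒dist : Walk G u v l → ∃[ d ] Dist G u v d
  walk⇒dist p = least-solution (λ j → walk? j _ _) p

  dist-split : ∀ a b → Dist G u w (a + b) → ∃[ v ] Dist G u v a × Dist G v w b
  dist-split a b (p , least) with splitWalk a p
  ... | v , p₁ , p₂ =
    v , (p₁ , λ j q → +-cancelʳ-≤ b a j (least (j + b) (q ++ʷ p₂)))
      , (p₂ , λ j q → +-cancelˡ-≤ a b j (least (a + j) (p₁ ++ʷ q)))

  dist0⇒≡ : Dist G u v 0 → u ≡ v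
  dist0⇒≡ (p , _) = walk0⇒≡ p

  dist-self : Dist G u u d → d ≡ 0
  dist-self (_ , least) = n≤0⇒n≡0 (least 0 here)

  dist-suc⇒≢ : Dist G u v (suc d) → u ≢ v
  dist-suc⇒≢ (_ , least) refl with least 0 here
  ... | ()

  edge⇒dist1 : Edge G u v → u ≢ v → Dist G u v 1
  edge⇒dist1 e u≢v = step e here , λ where
    zero    p → ⊥-elim (u≢v (walk0⇒≡ p))
    (suc j) p → s≤s z≤n

  dist-sym : SymmetricAdj G → Dist G u v d → Dist G v u d
  dist-sym sym-adj (p , least) = reverse sym-adj p , λ j q → least j (reverse sym-adj q)

  dist-by-potential : (f : Fin (order G) → ℕ) → (∀ x y → Edge G x y → f y ≤ suc (f x)) →
                      f u ≡ 0 → Walk G u v j → j ≤ f v → Dist G u v j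
  dist-by-potential f lip f-u≡0 p j≤f =
    p , λ i q → ≤-trans j≤f (subst (λ z → f _ ≤ z + i) f-u≡0 (walk-potential f lip q))

  dist-midpoint : SymmetricAdj G → Dist G u v d → ∃[ x ] Dist G x u ⌊ d /2⌋ × Dist G x v ⌈ d /2⌉
  dist-midpoint {d = d} sym-adj δ
    with dist-split ⌊ d /2⌋ ⌈ d /2⌉ (subst (Dist G _ _) (sym (⌊n/2⌋+⌈n/2⌉≡n d)) δ)
  ... | x , δ₁ , δ₂ = x , dist-sym sym-adj δ₁ , δ₂

  module _ {col : Fin (order G) → Parity} (sym-adj : SymmetricAdj G) (proper : ProperColouring G col) where

    same-colour⇒equidistant : Walk G u v l → col u ≡ col v → ∃₂ λ x d → Dist G x u d × Dist G x v d
    same-colour⇒equidistant {u = u} p same with walk⇒dist p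
    ... | D , δ with dist-midpoint sym-adj δ
    ... | x , δ₁ , δ₂ = x , ⌊ D /2⌋ , δ₁ , subst (Dist G x _) (⌈n/2⌉≡⌊n/2⌋ D even) δ₂
      where
      even : parity D ≡ 0ℙ
      even = ℙ.+-cancelʳ-≡ (col u) _ _ (trans (sym (walk-parity proper (proj₁ δ))) (sym same))

    opposite-colour⇒near-equidistant : Walk G u v l → col v ≡ col u ⁻¹ →
                                        ∃₂ λ x d → Dist G x u d × Dist G x v (suc d)
    opposite-colour⇒near-equidistant {u = u} p opposite with walk⇒dist p
    ... | D , δ with dist-midpoint sym-adj δ
    ... | x , δ₁ , δ₂ = x , ⌊ D /2⌋ , δ₁ , subst (Dist G x _) (⌈n/2⌉≡1+⌊n/2⌋ D odd) δ₂
      where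
      odd : parity D ≡ 1ℙ
      odd = ℙ.+-cancelʳ-≡ (col u) _ _ (trans (sym (walk-parity proper (proj₁ δ))) opposite)

-- Finite sums and colour classes

indicator : Bool → ℕ
indicator true  = 1
indicator false = 0

sum-mono-≤ : ∀ {n} {f g : Fin n → ℕ} → (∀ i → f i ≤ g i) → sum f ≤ sum g
sum-mono-≤ {zero}  f≤g = z≤n
sum-mono-≤ {suc n} f≤g = +-mono-≤ (f≤g zero) (sum-mono-≤ (λ i → f≤g (suc i)))

sum-const : ∀ n c → sum {n} (λ _ → c) ≡ n * c
sum-const zero    c = refl
sum-const (suc n) c = cong (c +_) (sum-const n c)

sum-↑ : ∀ a b (f : Fin (a + b) → ℕ) → sum f ≡ sum (λ i → f (i ↑ˡ b)) + sum (λ j → f (a ↑ʳ j))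
sum-↑ zero    b f = refl
sum-↑ (suc a) b f = trans (cong (f zero +_) (sum-↑ a b (λ i → f (suc i)))) (sym (+-assoc (f zero) _ _))

sum-combine : ∀ a b (f : Fin (a * b) → ℕ) → sum f ≡ sum (λ i → sum (λ j → f (combine {a} {b} i j)))
sum-combine zero    b f = refl
sum-combine (suc a) b f =
  trans (sum-↑ b (a * b) f) (cong (sum (λ j → f (j ↑ˡ (a * b))) +_) (sum-combine a b (λ x → f (b ↑ʳ x))))

∣S∣≡sum : ∀ {n} (S : Subset n) → ∣ S ∣ ≡ sum (λ x → indicator (lookup S x))
∣S∣≡sum []          = refl
∣S∣≡sum (true  ∷ S) = cong suc (∣S∣≡sum S)
∣S∣≡sum (false ∷ S) = ∣S∣≡sum S

sum≡0⇒≡0 : ∀ {n} (f : Fin n → ℕ) → sum f ≡ 0 → ∀ i → f i ≡ 0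
sum≡0⇒≡0 f sum≡0 zero    = m+n≡0⇒m≡0 (f zero) sum≡0
sum≡0⇒≡0 f sum≡0 (suc i) = sum≡0⇒≡0 (λ j → f (suc j)) (m+n≡0⇒n≡0 (f zero) sum≡0) i

∈⇒indicator≡1 : ∀ {n} {x : Fin n} {S : Subset n} → x ∈ S → indicator (lookup S x) ≡ 1
∈⇒indicator≡1 x∈S = cong indicator ([]=⇒lookup x∈S)

indicator≡0⇒∉ : ∀ {n} {x : Fin n} {S : Subset n} → indicator (lookup S x) ≡ 0 → x ∉ S
indicator≡0⇒∉ ind≡0 x∈S = 1+n≢0 (trans (sym (∈⇒indicator≡1 x∈S)) ind≡0)

δ : Parity → Parity → ℕ
δ p q = indicator (does (p ℙ.≟ q))

classSize : ∀ {n} → (Fin n → Parity) → Parity → ℕ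
classSize col p = sum (λ i → δ (col i) p)

sum-by-class : ∀ {n} (col : Fin n → Parity) p a b →
               sum (λ i → δ (col i) p * a + δ (col i) (p ⁻¹) * b) ≡ classSize col p * a + classSize col (p ⁻¹) * b
sum-by-class col p a b =
  trans (∑-distrib-+ (λ i → δ (col i) p * a) (λ i → δ (col i) (p ⁻¹) * b))
        (sym (cong₂ _+_ (*-distribʳ-sum a (λ i → δ (col i) p)) (*-distribʳ-sum b (λ i → δ (col i) (p ⁻¹)))))

classSize-+ : ∀ {n} (col : Fin n → Parity) → classSize col 1ℙ + classSize col 0ℙ ≡ n
classSize-+ {n} col = begin
  r + s                                           ≡⟨ cong₂ _+_ (*-identityʳ r) (*-identityʳ s) ⟨
  r * 1 + s * 1                                   ≡⟨ sum-by-class col 1ℙ 1 1 ⟨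
  sum (λ i → δ (col i) 1ℙ * 1 + δ (col i) 0ℙ * 1) ≡⟨ sum-cong-≗ (λ i → one-class (col i)) ⟩
  sum {n} (λ _ → 1)                               ≡⟨ trans (sum-const n 1) (*-identityʳ n) ⟩
  n                                               ∎
  where
  open ≡-Reasoning
  r = classSize col 1ℙ
  s = classSize col 0ℙ
  one-class : ∀ c → δ c 1ℙ * 1 + δ c 0ℙ * 1 ≡ 1
  one-class 0ℙ = refl
  one-class 1ℙ = refl

-- The corona G ⊙ H

module Corona (G H : Graph) where

  k m : ℕ
  k = order G
  m = order H

  C : Graph
  C = G ⊙ H

  V : Set
  V = Fin (order C)

  -- base i is v_i and copy i a is the vertex a of H_i; root x is the i whose block {v_i} ∪ H_i contains x,
  -- and depth x is 0 on v_i and 1 on H_i.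
  base : Fin k → V
  base i = i ↑ˡ (k * m)

  copy : Fin k → Fin m → V
  copy i a = k ↑ʳ combine i a

  data Kind : V → Set where
    at-base : ∀ i → Kind (base i)
    at-copy : ∀ i a → Kind (copy i a)

  kind : ∀ x → Kind x
  kind x = subst Kind (Fin.join-splitAt k (k * m) x) (kind-join (splitAt k x))
    where
    kind-join : ∀ y → Kind (join k (k * m) y)
    kind-join (inj₁ i) = at-base i
    kind-join (inj₂ y) = subst (Kind ∘ (k ↑ʳ_)) (Fin.combine-remQuot {k} m y)
                               (at-copy (proj₁ (remQuot {k} m y)) (proj₂ (remQuot {k} m y)))

  root : V → Fin k
  root x = [ id , proj₁ ∘ remQuot m ]′ (splitAt k x)

  depth : V → ℕ
  depth x = [ const 0 , const 1 ]′ (splitAt k x)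

  private
    splitAt-base : ∀ i → splitAt k (base i) ≡ inj₁ i
    splitAt-base i = Fin.splitAt-↑ˡ k i (k * m)

    splitAt-copy : ∀ i a → splitAt k (copy i a) ≡ inj₂ (combine i a)
    splitAt-copy i a = Fin.splitAt-↑ʳ k (k * m) (combine i a)

    quotient-combine : ∀ i a → proj₂ (quotRem {k} m (combine i a)) ≡ i
    quotient-combine i a = cong proj₁ (Fin.remQuot-combine {k} {m} i a)

    remainder-combine : ∀ i a → proj₁ (quotRem {k} m (combine i a)) ≡ a
    remainder-combine i a = cong proj₂ (Fin.remQuot-combine {k} {m} i a)

  root-base : ∀ i → root (base i) ≡ i
  root-base i rewrite splitAt-base i = refl

  root-copy : ∀ i a → root (copy i a) ≡ i
  root-copy i a rewrite splitAt-copy i a = quotient-combine i a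

  depth-base : ∀ i → depth (base i) ≡ 0
  depth-base i rewrite splitAt-base i = refl

  depth-copy : ∀ i a → depth (copy i a) ≡ 1
  depth-copy i a rewrite splitAt-copy i a = refl

  depth≤1 : ∀ x → depth x ≤ 1
  depth≤1 x with splitAt k x
  ... | inj₁ _ = z≤n
  ... | inj₂ _ = s≤s z≤n

  base≢copy : ∀ i j a → base i ≢ copy j a
  base≢copy i j a eq = 0≢1+n (trans (sym (depth-base i)) (trans (cong depth eq) (depth-copy j a)))

  adj-base-base : ∀ i j → adj C (base i) (base j) ≡ adj G i j
  adj-base-base i j rewrite splitAt-base i | splitAt-base j = refl

  adj-base-copy : ∀ i j a → adj C (base i) (copy j a) ≡ finEq i j
  adj-base-copy i j a rewrite splitAt-base i | splitAt-copy j a | quotient-combine j a = refl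

  adj-copy-base : ∀ i a j → adj C (copy i a) (base j) ≡ finEq i j
  adj-copy-base i a j rewrite splitAt-copy i a | splitAt-base j | quotient-combine i a = refl

  adj-copy-copy : ∀ i a j b → adj C (copy i a) (copy j b) ≡ (finEq i j ∧ adj H a b)
  adj-copy-copy i a j b
    rewrite splitAt-copy i a | splitAt-copy j b | quotient-combine i a | quotient-combine j b =
    cong₂ (λ x y → finEq i j ∧ adj H x y) (remainder-combine i a) (remainder-combine j b)

  edge-base : ∀ {i j} → Edge G i j → Edge C (base i) (base j)
  edge-base {i} {j} e = trans (adj-base-base i j) e

  edge-to-base : ∀ i a → Edge C (copy i a) (base i)
  edge-to-base i a = trans (adj-copy-base i a i) (finEq-refl i)

  edge-from-base : ∀ i a → Edge C (base i) (copy i a)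
  edge-from-base i a = trans (adj-base-copy i i a) (finEq-refl i)

  private
    roots-≡ : ∀ {x y i j} → root x ≡ i → root y ≡ j → i ≡ j → root x ≡ root y
    roots-≡ p q i≡j = trans p (trans i≡j (sym q))

  edge-cases : ∀ {x y} → Edge C x y →
               root x ≡ root y ⊎ (Edge G (root x) (root y) × depth x ≡ 0 × depth y ≡ 0)
  edge-cases {x} {y} e with kind x | kind y
  ... | at-base i | at-base j =
    inj₂ ( subst₂ (Edge G) (sym (root-base i)) (sym (root-base j)) (trans (sym (adj-base-base i j)) e)
         , depth-base i , depth-base j)
  ... | at-base i | at-copy j a =
    inj₁ (roots-≡ (root-base i) (root-copy j a) (finEq⇒≡ (trans (sym (adj-base-copy i j a)) e)))
  ... | at-copy i a | at-base j =
    inj₁ (roots-≡ (root-copy i a) (root-base j) (finEq⇒≡ (trans (sym (adj-copy-base i a j)) e)))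
  ... | at-copy i a | at-copy j b =
    inj₁ (roots-≡ (root-copy i a) (root-copy j b) (finEq⇒≡ (∧-true⇒ˡ (trans (sym (adj-copy-copy i a j b)) e))))
  lift : ∀ {i j l} → Walk G i j l → Walk C (base i) (base j) l
  lift here       = here
  lift (step e p) = step (edge-base e) (lift p)

  to-root : ∀ x → Walk C x (base (root x)) (depth x)
  to-root x with kind x
  ... | at-base i   rewrite root-base i   | depth-base i   = here
  ... | at-copy i a rewrite root-copy i a | depth-copy i a = step (edge-to-base i a) here

  from-root : ∀ x → Walk C (base (root x)) x (depth x)
  from-root x with kind x
  ... | at-base i   rewrite root-base i   | depth-base i   = here
  ... | at-copy i a rewrite root-copy i a | depth-copy i a = step (edge-from-base i a) here

  corona-walk : ∀ {x y l} → Walk G (root x) (root y) l → Walk C x y (depth x + (l + depth y))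
  corona-walk {x} {y} p = to-root x ++ʷ (lift p ++ʷ from-root y)

  depth-walk : ∀ {x y L} → Walk C x y L → depth y ≤ depth x + L
  depth-walk here                 = m≤m+n _ 0
  depth-walk {x} {y} (step {k = L} _ _) = ≤-trans (depth≤1 y) (≤-trans (s≤s z≤n) (m≤n+m (suc L) (depth x)))

  project : ∀ {x y L} → Walk C x y L →
            root x ≡ root y ⊎ ∃[ l ] Walk G (root x) (root y) l × depth x + (l + depth y) ≤ L
  project here = inj₁ refl
  project {x} {y} (step {v = x′} {k = L} e p) with edge-cases e | project p
  ... | inj₁ same | inj₁ same′ = inj₁ (trans same same′)
  ... | inj₁ same | inj₂ (l , q , bound) =
    inj₂ (l , subst (λ z → Walk G z (root y) l) (sym same) q , bound′)
    where
    open ≤-Reasoning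
    bound′ : depth x + (l + depth y) ≤ suc L
    bound′ = begin
      depth x + (l + depth y)        ≤⟨ +-monoˡ-≤ (l + depth y) (depth≤1 x) ⟩
      suc (l + depth y)              ≤⟨ s≤s (m≤n+m _ (depth x′)) ⟩
      suc (depth x′ + (l + depth y)) ≤⟨ s≤s bound ⟩
      suc L                          ∎
  ... | inj₂ (e′ , dx≡0 , dx′≡0) | inj₁ same′ =
    inj₂ (1 , step e′ (subst (λ z → Walk G (root x′) z 0) same′ here) , bound′)
    where
    bound′ : depth x + (1 + depth y) ≤ suc L
    bound′ rewrite dx≡0 = s≤s (subst (λ z → depth y ≤ z + L) dx′≡0 (depth-walk p))
  ... | inj₂ (e′ , dx≡0 , dx′≡0) | inj₂ (l , q , bound) =
    inj₂ (suc l , step e′ q , bound′)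
    where
    bound′ : depth x + (suc l + depth y) ≤ suc L
    bound′ rewrite dx≡0 = s≤s (subst (λ z → z + (l + depth y) ≤ L) dx′≡0 bound)

  corona-dist : ∀ {x y i j d} → root x ≡ i → root y ≡ j → i ≢ j →
                Dist G i j d → Dist C x y (depth x + (d + depth y))
  corona-dist {x} {y} {d = d} refl refl i≢j (p , least) = corona-walk p , shortest
    where
    shortest : ∀ L → Walk C x y L → depth x + (d + depth y) ≤ L
    shortest L q with project q
    ... | inj₁ same             = ⊥-elim (i≢j same)
    ... | inj₂ (l , q′ , bound) = ≤-trans (+-monoʳ-≤ (depth x) (+-monoˡ-≤ (depth y) (least l q′))) bound

  corona-dist⁻¹ : ∀ {x y i j D} → root x ≡ i → root y ≡ j → i ≢ j →
                  Dist C x y D → ∃[ d ] Dist G i j d × D ≡ depth x + (d + depth y)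
  corona-dist⁻¹ refl refl i≢j Δ with project (proj₁ Δ)
  ... | inj₁ same      = ⊥-elim (i≢j same)
  ... | inj₂ (l , q , _) with walk⇒dist q
  ...   | d , δ = d , δ , dist-unique Δ (corona-dist refl refl i≢j δ)

  same-block-dist : ∀ {x y D} → Dist C x y D → root x ≡ root y → D ≤ depth x + depth y
  same-block-dist {x} (_ , least) same = least _ (corona-walk (subst (λ z → Walk G (root x) z 0) same here))

  dist-base-copy : ∀ i a → Dist C (base i) (copy i a) 1
  dist-base-copy i a = edge⇒dist1 (edge-from-base i a) (base≢copy i i a)

  in-block : ∀ {x i} → root x ≡ i → x ≡ base i ⊎ ∃[ a ] x ≡ copy i a
  in-block {x} root≡i with kind x
  ... | at-base j   = inj₁ (cong base (trans (sym (root-base j)) root≡i))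
  ... | at-copy j a = inj₂ (a , cong (λ z → copy z a) (trans (sym (root-copy j a)) root≡i))

  EqualizedBy : Subset (order C) → V → V → Set
  EqualizedBy S u v = ∃[ w ] w ∈ S × ∃ λ D → Dist C w u D × Dist C w v D

  equalized-sym : ∀ {S u v} → EqualizedBy S u v → EqualizedBy S v u
  equalized-sym (w , w∈S , D , Δ₁ , Δ₂) = w , w∈S , D , Δ₂ , Δ₁

  equalize-via : ∀ {S w u v l i j d₁ d₂} → w ∈ S → root w ≡ l → root u ≡ i → root v ≡ j →
                 l ≢ i → l ≢ j → Dist G l i d₁ → Dist G l j d₂ → d₁ + depth u ≡ d₂ + depth v →
                 EqualizedBy S u v
  equalize-via {w = w} {v = v} w∈S root-w root-u root-v l≢i l≢j δ₁ δ₂ balanced =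
    w , w∈S , _ , corona-dist root-w root-u l≢i δ₁ ,
    subst (Dist C w v) (cong (depth w +_) (sym balanced)) (corona-dist root-w root-v l≢j δ₂)

  blockSize : Subset (order C) → Fin k → ℕ
  blockSize S i = indicator (lookup S (base i)) + sum (λ a → indicator (lookup S (copy i a)))

  ∣S∣≡∑blockSize : ∀ S → ∣ S ∣ ≡ sum (blockSize S)
  ∣S∣≡∑blockSize S = begin
    ∣ S ∣                                                 ≡⟨ ∣S∣≡sum S ⟩
    sum f                                                 ≡⟨ sum-↑ k (k * m) f ⟩
    sum (f ∘ base) + sum (f ∘ (k ↑ʳ_))                    ≡⟨ cong (sum (f ∘ base) +_) (sum-combine k m (f ∘ (k ↑ʳ_))) ⟩
    sum (f ∘ base) + sum (λ i → sum (λ a → f (copy i a))) ≡⟨ sym (∑-distrib-+ (f ∘ base) _) ⟩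
    sum (blockSize S)                                     ∎
    where
    open ≡-Reasoning
    f : V → ℕ
    f x = indicator (lookup S x)

  byLevel : (Fin k → ℕ → Bool) → Subset (order C)
  byLevel g = tabulate (λ x → g (root x) (depth x))

  ∈-byLevel : ∀ {g x} → g (root x) (depth x) ≡ true → x ∈ byLevel g
  ∈-byLevel {g} {x} eq = lookup⇒[]= x (byLevel g) (trans (lookup∘tabulate _ x) eq)

  blockSize-byLevel : ∀ g i → blockSize (byLevel g) i ≡ indicator (g i 0) + m * indicator (g i 1)
  blockSize-byLevel g i = cong₂ _+_
    (cong indicator (trans (lookup∘tabulate _ (base i)) (cong₂ g (root-base i) (depth-base i))))
    (trans (sum-cong-≗ (λ a → cong indicator (trans (lookup∘tabulate _ (copy i a))
                                                    (cong₂ g (root-copy i a) (depth-copy i a)))))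
           (sum-const m _))

  module LowerBound (a₀ : Fin m) {S : Subset (order C)} (equalizer : IsDistEqualizer C S) where

    block-meets : ∀ i → base i ∉ S → (∀ a → copy i a ∉ S) → ⊥
    block-meets i base∉S copies∉S
      with equalizer (base i) (copy i a₀) base∉S (copies∉S a₀) (base≢copy i i a₀)
    ... | w , w∈S , D , Δ₁ , Δ₂
      with corona-dist⁻¹ refl (root-base i) w∉block Δ₁ | corona-dist⁻¹ refl (root-copy i a₀) w∉block Δ₂
      where
      w∉block : root w ≢ i
      w∉block root≡i with in-block root≡i
      ... | inj₁ refl       = base∉S w∈S
      ... | inj₂ (a , refl) = copies∉S a w∈S
    ... | d₁ , δ₁ , D≡₁ | d₂ , δ₂ , D≡₂ rewrite dist-unique δ₁ δ₂ =
      0≢1+n (begin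
        0                          ≡⟨ sym (depth-base i) ⟩
        depth (base i)             ≡⟨ +-cancelˡ-≡ d₂ _ _ (+-cancelˡ-≡ (depth w) _ _ (trans (sym D≡₁) D≡₂)) ⟩
        depth (copy i a₀)          ≡⟨ depth-copy i a₀ ⟩
        1                          ∎)
      where open ≡-Reasoning

    1≤blockSize : ∀ i → 1 ≤ blockSize S i
    1≤blockSize i = n≢0⇒n>0 λ size≡0 →
      block-meets i (indicator≡0⇒∉ (m+n≡0⇒m≡0 _ size≡0))
                    (λ a → indicator≡0⇒∉ (sum≡0⇒≡0 _ (m+n≡0⇒n≡0 _ size≡0) a))

    k≤∣S∣ : k ≤ ∣ S ∣
    k≤∣S∣ = begin
      k                 ≡⟨ sym (trans (sum-const k 1) (*-identityʳ k)) ⟩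
      sum {k} (λ _ → 1) ≤⟨ sum-mono-≤ 1≤blockSize ⟩
      sum (blockSize S) ≡⟨ sym (∣S∣≡∑blockSize S) ⟩
      ∣ S ∣             ∎
      where open ≤-Reasoning

  module _ (a₀ : Fin m) (equidistant : EquidistantPairs G) where

    atBase : Fin k → ℕ → Bool
    atBase _ d = d ≡ᵇ 0

    bases : Subset (order C)
    bases = byLevel atBase

    base∈bases : ∀ i → base i ∈ bases
    base∈bases i = ∈-byLevel {atBase} {base i} (cong (_≡ᵇ 0) (depth-base i))

    ∣bases∣ : ∣ bases ∣ ≡ k
    ∣bases∣ = begin
      ∣ bases ∣                ≡⟨ ∣S∣≡∑blockSize bases ⟩
      sum (blockSize bases)    ≡⟨ sum-cong-≗ (λ i → trans (blockSize-byLevel atBase i) (cong suc (*-zeroʳ m))) ⟩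
      sum {k} (λ _ → 1)        ≡⟨ trans (sum-const k 1) (*-identityʳ k) ⟩
      k                        ∎
      where open ≡-Reasoning

    bases-equalizer : IsDistEqualizer C bases
    bases-equalizer u v u∉ v∉ u≢v with kind u | kind v
    ... | at-base i   | _         = ⊥-elim (u∉ (base∈bases i))
    ... | at-copy i a | at-base j = ⊥-elim (v∉ (base∈bases j))
    ... | at-copy i a | at-copy j b with i Fin.≟ j
    ...   | yes refl = base i , base∈bases i , 1 , dist-base-copy i a , dist-base-copy i b
    ...   | no i≢j with equidistant i j i≢j
    ...     | l , d , l≢i , l≢j , δ₁ , δ₂ =
      equalize-via (base∈bases l) (root-base l) (root-copy i a) (root-copy j b) l≢i l≢j δ₁ δ₂
                   (cong (d +_) (trans (depth-copy i a) (sym (depth-copy j b))))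

    ξ-corona-equidistant : XiIs C k
    ξ-corona-equidistant = (bases , bases-equalizer , ∣bases∣) , λ S eq → LowerBound.k≤∣S∣ a₀ eq

  module Bipartite (a₀ : Fin m) {col : Fin k → Parity}
                   (sym-adj : SymmetricAdj G) (proper : ProperColouring G col)
                   (connected : ∀ i j → ∃[ L ] Walk G i j L) where

    r s : ℕ
    r = classSize col 1ℙ
    s = classSize col 0ℙ

    -- S₀ contains v_i if col i ≡ 0ℙ and all of H_i if col i ≡ 1ℙ, the smaller class.
    colour-matches : Fin k → ℕ → Bool
    colour-matches i d = does (col i ℙ.≟ parity d)

    S₀ : Subset (order C)
    S₀ = byLevel colour-matches

    ∈S₀ : ∀ {x} → col (root x) ≡ parity (depth x) → x ∈ S₀
    ∈S₀ {x} matches = ∈-byLevel {colour-matches} {x} (dec-true (col (root x) ℙ.≟ parity (depth x)) matches)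

    ∉S₀ : ∀ {x} → x ∉ S₀ → col (root x) ≡ parity (depth x) ⁻¹
    ∉S₀ {x} x∉ = ≢⇒≡⁻¹ λ matches → x∉ (∈S₀ matches)

    colour-outside-base : ∀ {i} → base i ∉ S₀ → col i ≡ 1ℙ
    colour-outside-base {i} out = subst₂ (λ j d → col j ≡ parity d ⁻¹) (root-base i) (depth-base i) (∉S₀ out)

    colour-outside-copy : ∀ {i a} → copy i a ∉ S₀ → col i ≡ 0ℙ
    colour-outside-copy {i} {a} out = subst₂ (λ j d → col j ≡ parity d ⁻¹) (root-copy i a) (depth-copy i a) (∉S₀ out)

    base∈S₀ : ∀ {i} → col i ≡ 0ℙ → base i ∈ S₀
    base∈S₀ {i} c≡0 = ∈S₀ (subst₂ (λ j d → col j ≡ parity d) (sym (root-base i)) (sym (depth-base i)) c≡0)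

    copy∈S₀ : ∀ {i a} → col i ≡ 1ℙ → copy i a ∈ S₀
    copy∈S₀ {i} {a} c≡1 = ∈S₀ (subst₂ (λ j d → col j ≡ parity d) (sym (root-copy i a)) (sym (depth-copy i a)) c≡1)

    S₀-meets : ∀ l → ∃[ w ] w ∈ S₀ × root w ≡ l
    S₀-meets l with col l in c
    ... | 0ℙ = base l , base∈S₀ c , root-base l
    ... | 1ℙ = copy l a₀ , copy∈S₀ c , root-copy l a₀

    ∣S₀∣ : ∣ S₀ ∣ ≡ r * m + s
    ∣S₀∣ = begin
      ∣ S₀ ∣                                          ≡⟨ ∣S∣≡∑blockSize S₀ ⟩
      sum (blockSize S₀)                               ≡⟨ sum-cong-≗ (λ i → trans (blockSize-byLevel colour-matches i)
                                                                                  (block (col i))) ⟩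
      sum (λ i → δ (col i) 1ℙ * m + δ (col i) 0ℙ * 1) ≡⟨ sum-by-class col 1ℙ m 1 ⟩
      r * m + s * 1                                    ≡⟨ cong (r * m +_) (*-identityʳ s) ⟩
      r * m + s                                        ∎
      where
      open ≡-Reasoning
      block : ∀ c → indicator (does (c ℙ.≟ 0ℙ)) + m * indicator (does (c ℙ.≟ 1ℙ)) ≡ δ c 1ℙ * m + δ c 0ℙ * 1
      block 0ℙ = cong suc (*-zeroʳ m)
      block 1ℙ = trans (*-identityʳ m) (sym (trans (+-identityʳ (1 * m)) (*-identityˡ m)))

    equalize-same-colour : ∀ {u v i j} → root u ≡ i → root v ≡ j → i ≢ j → col i ≡ col j →
                           depth u ≡ depth v → EqualizedBy S₀ u v
    equalize-same-colour {i = i} {j} root-u root-v i≢j same depth-≡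
      with same-colour⇒equidistant sym-adj proper (proj₂ (connected i j)) same
    ... | l , d , δ₁ , δ₂ with S₀-meets l
    ... | w , w∈S₀ , root-w = equalize-via w∈S₀ root-w root-u root-v l≢i l≢j δ₁ δ₂ (cong (d +_) depth-≡)
      where
      l≢i : l ≢ i
      l≢i refl = i≢j (dist0⇒≡ (subst (Dist G l j) (dist-self δ₁) δ₂))
      l≢j : l ≢ j
      l≢j refl = i≢j (sym (dist0⇒≡ (subst (Dist G l i) (dist-self δ₂) δ₁)))

    equalize-base-copy : ∀ {i j b} → col i ≡ 1ℙ → col j ≡ 0ℙ → EqualizedBy S₀ (base i) (copy j b)
    equalize-base-copy {i} {j} {b} cᵢ cⱼ
      with opposite-colour⇒near-equidistant sym-adj proper (proj₂ (connected j i)) (trans cᵢ (sym (cong _⁻¹ cⱼ)))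
    ... | x , zero , δⱼ , δᵢ with dist0⇒≡ δⱼ
    ...   | refl = base j , base∈S₀ cⱼ , 1 ,
                   subst (Dist C (base j) (base i)) (cong₂ (λ a c → a + (1 + c)) (depth-base j) (depth-base i))
                         (corona-dist (root-base j) (root-base i) j≢i δᵢ) ,
                   dist-base-copy j b
      where
      j≢i : j ≢ i
      j≢i refl = ℙ.p≢p⁻¹ 0ℙ (trans (sym cⱼ) cᵢ)
    equalize-base-copy {i} {j} {b} cᵢ cⱼ | x , suc d , δⱼ , δᵢ with S₀-meets x
    ... | w , w∈S₀ , root-w =
      equalize-via w∈S₀ root-w (root-base i) (root-copy j b) (dist-suc⇒≢ δᵢ) (dist-suc⇒≢ δⱼ) δᵢ δⱼ balanced
      where
      balanced : suc (suc d) + depth (base i) ≡ suc d + depth (copy j b)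
      balanced rewrite depth-base i | depth-copy j b = trans (+-identityʳ _) (+-comm 1 (suc d))

    S₀-equalizer : IsDistEqualizer C S₀
    S₀-equalizer u v u∉ v∉ u≢v with kind u | kind v
    ... | at-base i | at-base j =
      equalize-same-colour (root-base i) (root-base j) (λ i≡j → u≢v (cong base i≡j))
        (trans (colour-outside-base u∉) (sym (colour-outside-base v∉)))
        (trans (depth-base i) (sym (depth-base j)))
    ... | at-base i | at-copy j b = equalize-base-copy (colour-outside-base u∉) (colour-outside-copy v∉)
    ... | at-copy i a | at-base j =
      equalized-sym (equalize-base-copy (colour-outside-base v∉) (colour-outside-copy u∉))
    ... | at-copy i a | at-copy j b with i Fin.≟ j
    ...   | yes refl = base i , base∈S₀ (colour-outside-copy u∉) , 1 , dist-base-copy i a , dist-base-copy i b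
    ...   | no i≢j =
      equalize-same-colour (root-copy i a) (root-copy j b) i≢j
        (trans (colour-outside-copy u∉) (sym (colour-outside-copy v∉)))
        (trans (depth-copy i a) (sym (depth-copy j b)))

    module _ {S : Subset (order C)} (equalizer : IsDistEqualizer C S) where
      open LowerBound a₀ equalizer using (1≤blockSize)

      nearer-in-own-block : ∀ {w u v D} → root w ≡ root u → root w ≢ root v → depth u ≡ depth v →
                            Dist C w u D → Dist C w v D → ⊥
      nearer-in-own-block {w} {u} {v} same diff depth-≡ Δᵤ Δᵥ with corona-dist⁻¹ refl refl diff Δᵥ
      ... | zero  , δ , _   = diff (dist0⇒≡ δ)
      ... | suc d , _ , D≡ = m+1+n≰m (depth v) (begin
        depth v + suc d           ≡⟨ +-comm (depth v) (suc d) ⟩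
        suc d + depth v           ≤⟨ +-cancelˡ-≤ (depth w) _ _ (begin
          depth w + (suc d + depth v) ≡⟨ sym D≡ ⟩
          _                           ≤⟨ same-block-dist Δᵤ same ⟩
          depth w + depth u           ∎) ⟩
        depth u                   ≡⟨ depth-≡ ⟩
        depth v                   ∎)
        where open ≤-Reasoning

      colour-separates : ∀ {w u v D} → depth u ≡ depth v → col (root v) ≡ col (root u) ⁻¹ →
                         Dist C w u D → Dist C w v D → ⊥
      colour-separates {w} {u} {v} depth-≡ opposite Δᵤ Δᵥ with root w Fin.≟ root u | root w Fin.≟ root v
      ... | yes wu | _ = nearer-in-own-block wu (λ wv → roots-differ (trans (sym wu) wv)) depth-≡ Δᵤ Δᵥ
        where
        roots-differ : root u ≢ root v
        roots-differ eq = ℙ.p≢p⁻¹ _ (trans (cong col eq) opposite)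
      ... | no _ | yes wv = nearer-in-own-block wv (λ wu → roots-differ (trans (sym wv) wu)) (sym depth-≡) Δᵥ Δᵤ
        where
        roots-differ : root v ≢ root u
        roots-differ eq = ℙ.p≢p⁻¹ _ (trans (cong col (sym eq)) opposite)
      ... | no wu | no wv with corona-dist⁻¹ refl refl wu Δᵤ | corona-dist⁻¹ refl refl wv Δᵥ
      ... | d₁ , δ₁ , D≡₁ | d₂ , δ₂ , D≡₂ = ℙ.p≢p⁻¹ _ (begin
        col (root u)                       ≡⟨ walk-parity proper (proj₁ δ₁) ⟩
        parity d₁ ℙ.+ col (root w)         ≡⟨ cong (λ d → parity d ℙ.+ col (root w)) d₁≡d₂ ⟩
        parity d₂ ℙ.+ col (root w)         ≡⟨ sym (walk-parity proper (proj₁ δ₂)) ⟩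
        col (root v)                       ≡⟨ opposite ⟩
        col (root u) ⁻¹                    ∎)
        where
        open ≡-Reasoning
        d₁≡d₂ : d₁ ≡ d₂
        d₁≡d₂ = +-cancelʳ-≡ (depth v) d₁ d₂
          (trans (cong (d₁ +_) (sym depth-≡)) (+-cancelˡ-≡ (depth w) _ _ (trans (sym D≡₁) D≡₂)))

      outside-copies-same-colour : ∀ {i a j b} → copy i a ∉ S → copy j b ∉ S → col i ≡ col j
      outside-copies-same-colour {i} {a} {j} {b} out₁ out₂ with col i ℙ.≟ col j
      ... | yes same = same
      ... | no differ with equalizer (copy i a) (copy j b) out₁ out₂ copies-differ
        where
        copies-differ : copy i a ≢ copy j b
        copies-differ eq = differ (cong col (trans (sym (root-copy i a)) (trans (cong root eq) (root-copy j b))))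
      ... | _ , _ , _ , Δ₁ , Δ₂ = ⊥-elim (colour-separates
        (trans (depth-copy i a) (sym (depth-copy j b)))
        (subst₂ (λ x y → col y ≡ col x ⁻¹) (sym (root-copy i a)) (sym (root-copy j b)) (≢⇒≡⁻¹ (differ ∘ sym)))
        Δ₁ Δ₂)

      outside-colour : ∃[ β ] ∀ i a → copy i a ∉ S → col i ≡ β
      outside-colour with Fin.any? (λ i → Fin.any? (λ a → ¬? (copy i a ∈? S)))
      ... | yes (i₀ , a₀′ , out₀) = col i₀ , λ i a out → outside-copies-same-colour out out₀
      ... | no none               = 0ℙ , λ i a out → ⊥-elim (none (i , a , out))

      copies⊆S⇒m≤blockSize : ∀ i → (∀ a → copy i a ∈ S) → m ≤ blockSize S i
      copies⊆S⇒m≤blockSize i copies∈S = begin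
        m                                          ≡⟨ trans (sum-const m 1) (*-identityʳ m) ⟨
        sum {m} (λ _ → 1)                           ≡⟨ sum-cong-≗ (λ a → ∈⇒indicator≡1 (copies∈S a)) ⟨
        sum (λ a → indicator (lookup S (copy i a))) ≤⟨ m≤n+m _ _ ⟩
        blockSize S i                              ∎
        where open ≤-Reasoning

      block-bound : ∀ β c i → (∀ a → copy i a ∉ S → c ≡ β) → δ c β * 1 + δ c (β ⁻¹) * m ≤ blockSize S i
      block-bound 0ℙ 0ℙ i _          = 1≤blockSize i
      block-bound 1ℙ 1ℙ i _          = 1≤blockSize i
      block-bound 0ℙ 1ℙ i monochrome = ≤-trans (≤-reflexive (+-identityʳ m)) (copies⊆S⇒m≤blockSize i λ a →
        decidable-stable (copy i a ∈? S) (λ out → ℙ.p≢p⁻¹ 1ℙ (monochrome a out)))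
      block-bound 1ℙ 0ℙ i monochrome = ≤-trans (≤-reflexive (+-identityʳ m)) (copies⊆S⇒m≤blockSize i λ a →
        decidable-stable (copy i a ∈? S) (λ out → ℙ.p≢p⁻¹ 0ℙ (monochrome a out)))

      lower-bound : r ≤ s → r * m + s ≤ ∣ S ∣
      lower-bound r≤s with outside-colour
      ... | β , monochrome = begin
        r * m + s                                                ≤⟨ arithmetic β ⟩
        classSize col β * 1 + classSize col (β ⁻¹) * m           ≡⟨ sum-by-class col β 1 m ⟨
        sum (λ i → δ (col i) β * 1 + δ (col i) (β ⁻¹) * m)       ≤⟨ sum-mono-≤ (λ i → block-bound β _ i (monochrome i)) ⟩
        sum (blockSize S)                                        ≡⟨ ∣S∣≡∑blockSize S ⟨
        ∣ S ∣                                                    ∎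
        where
        open ≤-Reasoning
        arithmetic : ∀ β → r * m + s ≤ classSize col β * 1 + classSize col (β ⁻¹) * m
        arithmetic 0ℙ = ≤-reflexive (trans (+-comm (r * m) s) (cong (_+ r * m) (sym (*-identityʳ s))))
        arithmetic 1ℙ = subst (λ z → r * m + s ≤ z + s * m) (sym (*-identityʳ r))
                              (r*m+s≤r+s*m r≤s (≤-trans (s≤s z≤n) (Fin.toℕ<n a₀)))

    ξ-corona-bipartite : r ≤ s → XiIs C (r * m + s)
    ξ-corona-bipartite r≤s = (S₀ , S₀-equalizer , ∣S₀∣) , λ S equalizer → lower-bound equalizer r≤s

-- Graphs presented by a relation on vertex indices

Presents : Graph → (ℕ → ℕ → Bool) → Set
Presents G R = ∀ x y → adj G x y ≡ R (toℕ x) (toℕ y)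

data RelWalk (n : ℕ) (R : ℕ → ℕ → Bool) : ℕ → ℕ → ℕ → Set where
  stop : ∀ {a} → RelWalk n R a a 0
  hop  : ∀ {a b c j} → b < n → R a b ≡ true → RelWalk n R b c j → RelWalk n R a c (suc j)

CommonNeighbours : ℕ → (ℕ → ℕ → Bool) → Set
CommonNeighbours n R = ∀ a b → a < n → b < n → a ≢ b →
                       ∃[ c ] c < n × c ≢ a × c ≢ b × R c a ≡ true × R c b ≡ true

module Presented {G : Graph} {R : ℕ → ℕ → Bool} (presents : Presents G R) where

  private
    n = order G

  edge : ∀ {x y} → R (toℕ x) (toℕ y) ≡ true → Edge G x y
  edge {x} {y} e = trans (presents x y) e

  toWalk : ∀ {a c j} → RelWalk n R a c j → ∀ {u v} → toℕ u ≡ a → toℕ v ≡ c → Walk G u v j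
  toWalk stop                 refl u≡v = subst (λ z → Walk G _ z 0) (Fin.toℕ-injective (sym u≡v)) here
  toWalk (hop {b = b} b<n e p) refl v≡c =
    step (edge (trans (cong (R _) (Fin.toℕ-fromℕ< b<n)) e)) (toWalk p (Fin.toℕ-fromℕ< b<n) v≡c)

  symmetric : (∀ a b → R a b ≡ R b a) → SymmetricAdj G
  symmetric R-sym u v = trans (presents u v) (trans (R-sym _ _) (sym (presents v u)))

  proper : (col : ℕ → Parity) → (∀ a b → a < n → b < n → R a b ≡ true → col b ≡ col a ⁻¹) →
           ProperColouring G (col ∘ toℕ)
  proper col flips u v e = flips _ _ (Fin.toℕ<n u) (Fin.toℕ<n v) (trans (sym (presents u v)) e)

  connected : (∀ a b → R a b ≡ R b a) → 0 < n → (∀ a → a < n → ∃[ L ] RelWalk n R a 0 L) →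
              ∀ u v → ∃[ L ] Walk G u v L
  connected R-sym 0<n reaches-0 u v with reaches-0 (toℕ u) (Fin.toℕ<n u) | reaches-0 (toℕ v) (Fin.toℕ<n v)
  ... | L₁ , p₁ | L₂ , p₂ =
    L₁ + L₂ , toWalk p₁ refl (Fin.toℕ-fromℕ< 0<n) ++ʷ reverse (symmetric R-sym) (toWalk p₂ refl (Fin.toℕ-fromℕ< 0<n))

  equidistant : CommonNeighbours n R → EquidistantPairs G
  equidistant common i j i≢j
    with common (toℕ i) (toℕ j) (Fin.toℕ<n i) (Fin.toℕ<n j) (i≢j ∘ Fin.toℕ-injective)
  ... | c , c<n , c≢i , c≢j , e₁ , e₂ =
    fromℕ< c<n , 1 , l≢ c≢i , l≢ c≢j , adjacent e₁ c≢i , adjacent e₂ c≢j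
    where
    l≡c : toℕ (fromℕ< c<n) ≡ c
    l≡c = Fin.toℕ-fromℕ< c<n
    l≢ : ∀ {x} → c ≢ toℕ x → fromℕ< c<n ≢ x
    l≢ c≢x refl = c≢x (sym l≡c)
    adjacent : ∀ {x} → R c (toℕ x) ≡ true → c ≢ toℕ x → Dist G (fromℕ< c<n) x 1
    adjacent e c≢x = edge⇒dist1 (edge (trans (cong (λ z → R z _) l≡c) e)) (l≢ c≢x)

classSizeBelow : ℕ → (ℕ → Parity) → Parity → ℕ
classSizeBelow n col = classSize {n} (col ∘ toℕ)

side : ℕ → ℕ → Parity
side r a = if a <ᵇ r then 1ℙ else 0ℙ

classSize-side : ∀ r s → classSizeBelow (r + s) (side r) 1ℙ ≡ r
classSize-side zero    s = trans (sum-const s 0) (*-zeroʳ s)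
classSize-side (suc r) s = cong suc (classSize-side r s)

classSize-parity : ∀ n → classSizeBelow n parity 1ℙ ≡ ⌊ n /2⌋
classSize-parity zero          = refl
classSize-parity (suc zero)    = refl
classSize-parity (suc (suc n)) = cong suc (classSize-parity n)

module _ (H : Graph) (a₀ : Fin (order H)) where

  ξ-presented-bipartite :
    ∀ {G R} → Presents G R → (∀ a b → R a b ≡ R b a) →
    (col : ℕ → Parity) → (∀ a b → a < order G → b < order G → R a b ≡ true → col b ≡ col a ⁻¹) →
    0 < order G → (∀ a → a < order G → ∃[ L ] RelWalk (order G) R a 0 L) →
    ∀ {r s} → classSizeBelow (order G) col 1ℙ ≡ r → r + s ≡ order G → r ≤ s →
    XiIs (G ⊙ H) (r * order H + s)
  ξ-presented-bipartite {G} {R} presents R-sym col flips 0<n reaches-0 {r} {s} r≡ r+s≡n r≤s =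
    subst₂ (λ r s → XiIs (G ⊙ H) (r * order H + s)) r≡ s≡
      (Corona.Bipartite.ξ-corona-bipartite G H a₀ (symmetric R-sym) (proper col flips)
        (connected R-sym 0<n reaches-0) (subst₂ _≤_ (sym r≡) (sym s≡) r≤s))
    where
    open Presented {R = R} presents
    s≡ : classSizeBelow (order G) col 0ℙ ≡ s
    s≡ = +-cancelˡ-≡ r _ _ (trans (cong (_+ classSizeBelow (order G) col 0ℙ) (sym r≡))
                                  (trans (classSize-+ (col ∘ toℕ)) (sym r+s≡n)))

  -- G is bipartite with sides [0, r) and [r, r + s) and contains the double star with centres 0 and r.
  ξ-split-bipartite :
    ∀ {G R} r s → 1 ≤ r → r ≤ s → order G ≡ r + s → Presents G R → (∀ a b → R a b ≡ R b a) →
    (∀ a b → a < r + s → b < r + s → R a b ≡ true → side r b ≡ side r a ⁻¹) →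
    (∀ a → a < r → R a r ≡ true) → (∀ b → r ≤ b → b < r + s → R b 0 ≡ true) →
    XiIs (G ⊙ H) (r * order H + s)
  ξ-split-bipartite {G} {R} r s 1≤r r≤s n≡r+s presents R-sym crossing to-r to-0 =
    ξ-presented-bipartite presents R-sym (side r) flips 0<n reaches-0
      (subst (λ n → classSizeBelow n (side r) 1ℙ ≡ r) (sym n≡r+s) (classSize-side r s)) (sym n≡r+s) r≤s
    where
    flips : ∀ a b → a < order G → b < order G → R a b ≡ true → side r b ≡ side r a ⁻¹
    flips a b a< b< = crossing a b (subst (a <_) n≡r+s a<) (subst (b <_) n≡r+s b<)
    r<n : r < order G
    r<n = subst (r <_) (sym n≡r+s) (subst (_< r + s) (+-identityʳ r) (+-monoʳ-< r (≤-trans 1≤r r≤s)))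
    0<n : 0 < order G
    0<n = <-≤-trans 1≤r (<⇒≤ r<n)
    reaches-0 : ∀ a → a < order G → ∃[ L ] RelWalk (order G) R a 0 L
    reaches-0 zero    _ = 0 , stop
    reaches-0 (suc a) a<n with suc a <? r
    ... | yes a<r = 2 , hop r<n (to-r (suc a) a<r) (hop 0<n (trans (R-sym r 0) (to-r 0 1≤r)) stop)
    ... | no  a≮r = 1 , hop 0<n (to-0 (suc a) (≮⇒≥ a≮r) (subst (suc a <_) n≡r+s a<n)) stop

  ξ-parity-bipartite :
    ∀ {G R} → Presents G R → (∀ a b → R a b ≡ R b a) → 0 < order G →
    (∀ a b → a < order G → b < order G → R a b ≡ true → parity b ≡ parity a ⁻¹) →
    (∀ a → suc a < order G → R (suc a) a ≡ true) →
    XiIs (G ⊙ H) (⌊ order G /2⌋ * order H + ⌈ order G /2⌉)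
  ξ-parity-bipartite {G} {R} presents R-sym 0<n flips down =
    ξ-presented-bipartite presents R-sym parity flips 0<n reaches-0
      (classSize-parity (order G)) (⌊n/2⌋+⌈n/2⌉≡n (order G)) (⌊n/2⌋≤⌈n/2⌉ (order G))
    where
    reaches-0 : ∀ a → a < order G → ∃[ L ] RelWalk (order G) R a 0 L
    reaches-0 zero    _   = 0 , stop
    reaches-0 (suc a) a<n with reaches-0 a (<-trans (n<1+n a) a<n)
    ... | L , p = suc L , hop (<-trans (n<1+n a) a<n) (down a a<n) p

-- Complete bipartite graphs, bistars and K₂

crossesAt : ℕ → ℕ → ℕ → Bool
crossesAt r a b = (a <ᵇ r) xor (b <ᵇ r)

crossing-flips-side : ∀ r a b → crossesAt r a b ≡ true → side r b ≡ side r a ⁻¹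
crossing-flips-side r a b crosses with a <ᵇ r | b <ᵇ r
... | true  | false = refl
... | false | true  = refl
crossing-flips-side r a b () | true  | true
crossing-flips-side r a b () | false | false

Krs-presented : ∀ r s → Presents (Krs r s) (crossesAt r)
Krs-presented r s x y with toℕ x <ᵇ r | toℕ y <ᵇ r
... | true  | true  = refl
... | true  | false = refl
... | false | true  = refl
... | false | false = refl

K2-presented : Presents (Kn 2) (crossesAt 1)
K2-presented zero       zero       = refl
K2-presented zero       (suc zero) = refl
K2-presented (suc zero) zero       = refl
K2-presented (suc zero) (suc zero) = refl

bistar-crosses : ∀ r a b → bistarRel r a b ≡ true → crossesAt r a b ≡ true
bistar-crosses r a b adjacent with a <ᵇ r | b <ᵇ r
... | true  | false = refl
... | false | true  = refl
bistar-crosses r a b () | true  | true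
bistar-crosses r a b () | false | false

bistarRel-sym : ∀ r a b → bistarRel r a b ≡ bistarRel r b a
bistarRel-sym r a b = ∨-comm (towards a b) (towards b a)
  where
  towards : ℕ → ℕ → Bool
  towards a b = (a <ᵇ r) ∧ not (b <ᵇ r) ∧ ((a ≡ᵇ 0) ∨ (b ≡ᵇ r))

bistar-to-r : ∀ r a → a < r → bistarRel r a r ≡ true
bistar-to-r r a a<r rewrite <⇒<ᵇ≡true a<r | ≥⇒<ᵇ≡false (≤-refl {r}) | ≡ᵇ-refl r | ∨-zeroʳ (a ≡ᵇ 0) = refl

bistar-to-0 : ∀ r b → 1 ≤ r → r ≤ b → bistarRel r b 0 ≡ true
bistar-to-0 r b 1≤r r≤b rewrite ≥⇒<ᵇ≡false r≤b | <⇒<ᵇ≡true 1≤r = refl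

-- Paths and cycles

absDiff≡∣-∣ : ∀ a b → absDiff a b ≡ ∣ a - b ∣
absDiff≡∣-∣ zero    zero    = refl
absDiff≡∣-∣ zero    (suc b) = refl
absDiff≡∣-∣ (suc a) zero    = +-identityʳ (suc a)
absDiff≡∣-∣ (suc a) (suc b) = absDiff≡∣-∣ a b

∣1+n-n∣≡1 : ∀ n → ∣ suc n - n ∣ ≡ 1
∣1+n-n∣≡1 zero    = refl
∣1+n-n∣≡1 (suc n) = ∣1+n-n∣≡1 n

∣m-n∣≡1⇒adjacent : ∀ m n → ∣ m - n ∣ ≡ 1 → n ≡ suc m ⊎ m ≡ suc n
∣m-n∣≡1⇒adjacent zero          (suc zero) _  = inj₁ refl
∣m-n∣≡1⇒adjacent (suc zero)    zero       _  = inj₂ refl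
∣m-n∣≡1⇒adjacent (suc m)       (suc n)    eq = Sum.map (cong suc) (cong suc) (∣m-n∣≡1⇒adjacent m n eq)
∣m-n∣≡1⇒adjacent zero          zero       ()
∣m-n∣≡1⇒adjacent zero          (suc (suc n)) ()
∣m-n∣≡1⇒adjacent (suc (suc m)) zero       ()

∣m-n∣≡1⇒parity-flips : ∀ m n → ∣ m - n ∣ ≡ 1 → parity n ≡ parity m ⁻¹
∣m-n∣≡1⇒parity-flips m n eq with ∣m-n∣≡1⇒adjacent m n eq
... | inj₁ refl = parity-suc m
... | inj₂ refl = sym (ℙ.suc-homo-⁻¹ n)

unit-step : ℕ → ℕ → Bool
unit-step a b = absDiff a b ≡ᵇ 1

unit-step-sym : ∀ a b → unit-step a b ≡ unit-step b a
unit-step-sym a b = cong (_≡ᵇ 1) (+-comm (a ∸ b) (b ∸ a))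

unit-step-flips-parity : ∀ a b → unit-step a b ≡ true → parity b ≡ parity a ⁻¹
unit-step-flips-parity a b eq = ∣m-n∣≡1⇒parity-flips a b (trans (sym (absDiff≡∣-∣ a b)) (≡ᵇ-true⇒≡ eq))

unit-step-down : ∀ a → unit-step (suc a) a ≡ true
unit-step-down a = cong (_≡ᵇ 1) (trans (absDiff≡∣-∣ (suc a) a) (∣1+n-n∣≡1 a))

cycRel-sym : ∀ n a b → cycRel n a b ≡ cycRel n b a
cycRel-sym n a b = cong (λ d → (d ≡ᵇ 1) ∨ (d ≡ᵇ (n ∸ 1))) (+-comm (a ∸ b) (b ∸ a))

cycRel-cases : ∀ n a b → cycRel n a b ≡ true → ∣ a - b ∣ ≡ 1 ⊎ ∣ a - b ∣ ≡ n ∸ 1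
cycRel-cases n a b adjacent with absDiff a b ≡ᵇ 1 in unit
... | true  = inj₁ (trans (sym (absDiff≡∣-∣ a b)) (≡ᵇ-true⇒≡ unit))
... | false = inj₂ (trans (sym (absDiff≡∣-∣ a b)) (≡ᵇ-true⇒≡ adjacent))

cycRel-down : ∀ n a → cycRel n (suc a) a ≡ true
cycRel-down n a = cong (_∨ (absDiff (suc a) a ≡ᵇ (n ∸ 1))) (unit-step-down a)

gap-ends : ∀ {a b n} → a ≤ b → b < n → b ∸ a ≡ n ∸ 1 → a ≡ 0 × b ≡ n ∸ 1
gap-ends {a} {b} {suc n} a≤b (s≤s b≤n) gap = a≡0 , b≡n
  where
  b≡n : b ≡ n
  b≡n = ≤-antisym b≤n (subst (_≤ b) gap (m∸n≤m b a))
  a≡0 : a ≡ 0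
  a≡0 = +-cancelʳ-≡ b a 0 (trans (cong (a +_) (sym (trans gap (sym b≡n)))) (m+[n∸m]≡n a≤b))

wrap-ends : ∀ {n a b} → a < n → b < n → ∣ a - b ∣ ≡ n ∸ 1 → (a ≡ 0 × b ≡ n ∸ 1) ⊎ (b ≡ 0 × a ≡ n ∸ 1)
wrap-ends {a = a} {b} a<n b<n wrap with ≤-total a b
... | inj₁ a≤b = inj₁ (gap-ends a≤b b<n (trans (sym (m≤n⇒∣m-n∣≡n∸m a≤b)) wrap))
... | inj₂ b≤a = inj₂ (gap-ends b≤a a<n (trans (sym (m≤n⇒∣n-m∣≡n∸m b≤a)) wrap))

even⇒pred-odd : ∀ n → parity n ≡ 0ℙ → 0 < n → parity (n ∸ 1) ≡ 1ℙ
even⇒pred-odd (suc n) even _ = ℙ.⁻¹-injective (trans (sym (parity-suc n)) even)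

even-cycle-flips : ∀ n → parity n ≡ 0ℙ → ∀ a b → a < n → b < n → cycRel n a b ≡ true → parity b ≡ parity a ⁻¹
even-cycle-flips n even a b a<n b<n adjacent with cycRel-cases n a b adjacent
... | inj₁ unit = ∣m-n∣≡1⇒parity-flips a b unit
... | inj₂ wrap with wrap-ends a<n b<n wrap
...   | inj₁ (refl , refl) = even⇒pred-odd n even a<n
...   | inj₂ (refl , refl) = sym (cong _⁻¹ (even⇒pred-odd n even b<n))

even-cycle-size : ∀ n m → parity n ≡ 0ℙ → ⌊ n /2⌋ * m + ⌈ n /2⌉ ≡ n * (m + 1) / 2
even-cycle-size n m even = begin
  h * m + ⌈ n /2⌉              ≡⟨ cong (h * m +_) (⌈n/2⌉≡⌊n/2⌋ n even) ⟩
  h * m + h                    ≡⟨ m*n/n≡m (h * m + h) 2 ⟨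
  (h * m + h) * 2 / 2          ≡⟨ cong (_/ 2) (solve 2 (λ h m → (h :* m :+ h) :* con 2 := (h :+ h) :* (m :+ con 1))
                                                        refl h m) ⟩
  (h + h) * (m + 1) / 2        ≡⟨ cong (λ z → z * (m + 1) / 2) (⌊n/2⌋+⌊n/2⌋≡n n even) ⟩
  n * (m + 1) / 2              ∎
  where
  open ≡-Reasoning
  open +-*-Solver
  h = ⌊ n /2⌋

cycDist : ℕ → ℕ → ℕ → ℕ
cycDist n a b = ∣ a - b ∣ ⊓ (n ∸ ∣ a - b ∣)

cycDist-self : ∀ n a → cycDist n a a ≡ 0
cycDist-self n a rewrite ∣n-n∣≡0 a = refl

private
  1+m∸n≤1+[m∸n] : ∀ m n → suc m ∸ n ≤ suc (m ∸ n)
  1+m∸n≤1+[m∸n] m       zero    = ≤-refl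
  1+m∸n≤1+[m∸n] zero    (suc n) = ≤-trans (≤-reflexive (0∸n≡0 n)) z≤n
  1+m∸n≤1+[m∸n] (suc m) (suc n) = 1+m∸n≤1+[m∸n] m n

  ∸-lipschitz : ∀ n {A B} → A ≤ suc B → n ∸ B ≤ suc (n ∸ A)
  ∸-lipschitz n {A} A≤1+B = ≤-trans (∸-monoʳ-≤ (suc n) A≤1+B) (1+m∸n≤1+[m∸n] n A)

  cycDist-unit : ∀ n a x y → ∣ x - y ∣ ≡ 1 → cycDist n a y ≤ suc (cycDist n a x)
  cycDist-unit n a x y unit = ⊓-mono-≤ (close a x y unit) (∸-lipschitz n (close a y x (trans (∣-∣-comm y x) unit)))
    where
    close : ∀ a x y → ∣ x - y ∣ ≡ 1 → ∣ a - y ∣ ≤ suc ∣ a - x ∣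
    close a x y unit = ≤-trans (∣-∣-triangle a x y) (≤-reflexive (trans (cong (∣ a - x ∣ +_) unit) (+-comm _ 1)))

  cycDist-zero : ∀ n a → cycDist n a 0 ≡ a ⊓ (n ∸ a)
  cycDist-zero n a = cong (λ d → d ⊓ (n ∸ d)) (∣-∣-identityʳ a)

  cycDist-last : ∀ n a → a < n → cycDist n a (n ∸ 1) ≡ (n ∸ suc a) ⊓ suc a
  cycDist-last (suc n) a (s≤s a≤n) = cong₂ _⊓_ |a-n|≡ (trans (cong (suc n ∸_) |a-n|≡) (m∸[m∸n]≡n (s≤s a≤n)))
    where
    |a-n|≡ : ∣ a - n ∣ ≡ n ∸ a
    |a-n|≡ = m≤n⇒∣m-n∣≡n∸m a≤n

cycDist-lipschitz : ∀ {n a x y} → a < n → x < n → y < n → cycRel n x y ≡ true →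
                    cycDist n a y ≤ suc (cycDist n a x)
cycDist-lipschitz {n} {a} {x} {y} a<n x<n y<n adjacent with cycRel-cases n x y adjacent
... | inj₁ unit = cycDist-unit n a x y unit
... | inj₂ wrap with wrap-ends x<n y<n wrap
...   | inj₁ (refl , refl) rewrite cycDist-zero n a | cycDist-last n a a<n =
  ≤-trans (≤-reflexive (⊓-comm (n ∸ suc a) (suc a)))
          (⊓-monoʳ-≤ (suc a) (≤-trans (∸-monoʳ-≤ n (n≤1+n a)) (n≤1+n (n ∸ a))))
...   | inj₂ (refl , refl) rewrite cycDist-zero n a | cycDist-last n a a<n =
  ≤-trans (≤-reflexive (⊓-comm a (n ∸ a)))
          (subst (λ z → (n ∸ a) ⊓ a ≤ z ⊓ suc (suc a)) (+-∸-assoc 1 a<n)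
                 (⊓-monoʳ-≤ (n ∸ a) (≤-trans (n≤1+n a) (n≤1+n (suc a)))))

private
  wrapped-shift : ∀ {n x h y} → x < n → h + h ≤ n → n + y ≡ x + h → y < n × ∣ x - y ∣ ≡ n ∸ h
  wrapped-shift {n} {x} {h} {y} x<n 2h≤n n+y≡x+h = y<n , |x-y|≡n∸h
    where
    h≤n : h ≤ n
    h≤n = ≤-trans (m≤m+n h h) 2h≤n
    y<n : y < n
    y<n = <-≤-trans (+-cancelˡ-< n y h (subst (_< n + h) (sym n+y≡x+h) (+-monoˡ-< h x<n))) h≤n
    |x-y|≡n∸h : ∣ x - y ∣ ≡ n ∸ h
    |x-y|≡n∸h = begin
      ∣ x - y ∣             ≡⟨ ∣m+n-m+o∣≡∣n-o∣ h x y ⟨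
      ∣ h + x - h + y ∣     ≡⟨ cong₂ ∣_-_∣ (trans (+-comm h x) (trans (sym n+y≡x+h) (+-comm n y))) (+-comm h y) ⟩
      ∣ y + n - y + h ∣     ≡⟨ ∣m+n-m+o∣≡∣n-o∣ y n h ⟩
      ∣ n - h ∣             ≡⟨ m≤n⇒∣n-m∣≡n∸m h≤n ⟩
      n ∸ h                 ∎
      where open ≡-Reasoning

cycDist-shift : ∀ {n} .{{_ : NonZero n}} {x h} → x < n → h + h ≤ n → cycDist n x ((x + h) % n) ≡ h
cycDist-shift {n@(suc _)} {x} {h} x<n 2h≤n with x + h <? n
... | yes x+h<n rewrite m<n⇒m%n≡m x+h<n | ∣m-m+n∣≡n x h = m≤n⇒m⊓n≡m (m+n≤o⇒m≤o∸n h 2h≤n)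
... | no x+h≮n with m≤n⇒∃[o]m+o≡n (≮⇒≥ x+h≮n)
...   | y , n+y≡x+h with wrapped-shift x<n 2h≤n n+y≡x+h
...     | y<n , |x-y|≡n∸h = begin
  cycDist n x ((x + h) % n)     ≡⟨ cong (λ z → cycDist n x (z % n)) (trans (sym n+y≡x+h) (+-comm n y)) ⟩
  cycDist n x ((y + n) % n)     ≡⟨ cong (cycDist n x) (trans ([m+n]%n≡m%n y n) (m<n⇒m%n≡m y<n)) ⟩
  cycDist n x y                 ≡⟨ cong (λ d → d ⊓ (n ∸ d)) |x-y|≡n∸h ⟩
  (n ∸ h) ⊓ (n ∸ (n ∸ h))       ≡⟨ cong ((n ∸ h) ⊓_) (m∸[m∸n]≡n (≤-trans (m≤m+n h h) 2h≤n)) ⟩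
  (n ∸ h) ⊓ h                   ≡⟨ m≥n⇒m⊓n≡n (m+n≤o⇒m≤o∸n h 2h≤n) ⟩
  h                             ∎
  where open ≡-Reasoning

cycRel-wrap : ∀ x → cycRel (suc x) x 0 ≡ true
cycRel-wrap x rewrite 0∸n≡0 x | +-identityʳ x | ≡ᵇ-refl x = ∨-zeroʳ (x ≡ᵇ 1)

cycle-step : ∀ {n} .{{_ : NonZero n}} {x} → x < n → cycRel n x (suc x % n) ≡ true
cycle-step {n} {x} x<n with suc x <? n
... | yes 1+x<n rewrite m<n⇒m%n≡m 1+x<n =
  cong (_∨ (absDiff x (suc x) ≡ᵇ (n ∸ 1))) (trans (unit-step-sym x (suc x)) (unit-step-down x))
... | no 1+x≮n with ≤-antisym x<n (≮⇒≥ 1+x≮n)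
...   | refl = subst (λ z → cycRel (suc x) x z ≡ true) (sym (n%n≡0 (suc x))) (cycRel-wrap x)

cycle-walk : ∀ {n} .{{_ : NonZero n}} t {x y} → x < n → (x + t) % n ≡ y → RelWalk n (cycRel n) x y t
cycle-walk {n} zero {x} x<n x%n≡y =
  subst (λ y → RelWalk n (cycRel n) x y 0)
        (trans (sym (m<n⇒m%n≡m x<n)) (trans (cong (_% n) (sym (+-identityʳ x))) x%n≡y)) stop
cycle-walk {n} (suc t) {x} x<n x+t%n≡y =
  hop (m%n<n (suc x) n) (cycle-step x<n)
      (cycle-walk t (m%n<n (suc x) n)
        (trans ([m%n+k]%n≡[m+k]%n (suc x) t n) (trans (cong (_% n) (sym (+-suc x t))) x+t%n≡y)))

cycle-dist-shift : ∀ {n} .{{_ : NonZero n}} (x y : Fin n) h → h + h ≤ n → (toℕ x + h) % n ≡ toℕ y →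
                   Dist (Cn n) x y h
cycle-dist-shift {n} x y h 2h≤n x+h≡y =
  dist-by-potential (cycDist n (toℕ x) ∘ toℕ)
    (λ u v e → cycDist-lipschitz (Fin.toℕ<n x) (Fin.toℕ<n u) (Fin.toℕ<n v) e)
    (cycDist-self n (toℕ x))
    (Presented.toWalk {R = cycRel n} (λ _ _ → refl) (cycle-walk h (Fin.toℕ<n x) x+h≡y) refl refl)
    (≤-reflexive (sym (trans (cong (cycDist n (toℕ x)) (sym x+h≡y)) (cycDist-shift (Fin.toℕ<n x) 2h≤n))))

cycle-midpoint : ∀ {n} .{{_ : NonZero n}} (p q : Fin n) h → 1 ≤ h → h + h ≤ n →
                 (toℕ p + (h + h)) % n ≡ toℕ q → Equidistant (Cn n) p q
cycle-midpoint {n} p q h@(suc _) _ 2h≤n p+2h≡q = l , h , dist-suc⇒≢ δ-p , dist-suc⇒≢ δ-q , δ-p , δ-q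
  where
  l : Fin n
  l = fromℕ< (m%n<n (toℕ p + h) n)
  l≡ : toℕ l ≡ (toℕ p + h) % n
  l≡ = Fin.toℕ-fromℕ< _
  δ-p : Dist (Cn n) l p h
  δ-p = dist-sym (Presented.symmetric {R = cycRel n} (λ _ _ → refl) (cycRel-sym n)) (cycle-dist-shift p l h 2h≤n (sym l≡))
  δ-q : Dist (Cn n) l q h
  δ-q = cycle-dist-shift l q h 2h≤n (begin
    (toℕ l + h) % n               ≡⟨ cong (λ z → (z + h) % n) l≡ ⟩
    ((toℕ p + h) % n + h) % n     ≡⟨ [m%n+k]%n≡[m+k]%n (toℕ p + h) h n ⟩
    (toℕ p + h + h) % n           ≡⟨ cong (_% n) (+-assoc (toℕ p) h h) ⟩
    (toℕ p + (h + h)) % n         ≡⟨ p+2h≡q ⟩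
    toℕ q                         ∎)
    where open ≡-Reasoning

-- On an odd cycle one of the two arcs between two vertices has even length 2h (EvenArc, read upwards
-- mod n), and its midpoint lies at distance h from both ends.
EvenArc : (n : ℕ) .{{_ : NonZero n}} → ℕ → ℕ → Set
EvenArc n a b = ∃[ h ] 1 ≤ h × h + h ≤ n × (a + (h + h)) % n ≡ b

even-arc-inside : ∀ {n} .{{_ : NonZero n}} {a b} → parity (b ∸ a) ≡ 0ℙ → a < b → b < n → EvenArc n a b
even-arc-inside {n} {a} {b} parity-D a<b b<n = arc (even-halves D parity-D (m<n⇒0<n∸m a<b))
  where
  D = b ∸ a
  arc : ∃[ h ] 1 ≤ h × h + h ≡ D → EvenArc n a b
  arc (h , 1≤h , h+h≡D) = h , 1≤h , subst (_≤ n) (sym h+h≡D) (≤-trans (m∸n≤m b a) (<⇒≤ b<n)) , (begin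
    (a + (h + h)) % n     ≡⟨ cong (λ z → (a + z) % n) h+h≡D ⟩
    (a + D) % n           ≡⟨ cong (_% n) (m+[n∸m]≡n (<⇒≤ a<b)) ⟩
    b % n                 ≡⟨ m<n⇒m%n≡m b<n ⟩
    b                     ∎)
    where open ≡-Reasoning

even-arc-around : ∀ {n} .{{_ : NonZero n}} {a b} → parity n ≡ 1ℙ → parity (b ∸ a) ≡ 1ℙ → a < b → b < n →
                  EvenArc n b a
even-arc-around {n} {a} {b} odd parity-D a<b b<n = arc (even-halves E parity-E (m<n⇒0<n∸m D<n))
  where
  open ≡-Reasoning
  D = b ∸ a
  E = n ∸ D
  D<n : D < n
  D<n = ≤-<-trans (m∸n≤m b a) b<n
  parity-E : parity E ≡ 0ℙ
  parity-E = sym (ℙ.⁻¹-selfInverse (begin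
    parity E ⁻¹              ≡⟨ cong (ℙ._+ parity E) parity-D ⟨
    parity D ℙ.+ parity E    ≡⟨ ℙ.+-homo-+ D E ⟨
    parity (D + E)           ≡⟨ cong parity (m+[n∸m]≡n (<⇒≤ D<n)) ⟩
    parity n                 ≡⟨ odd ⟩
    1ℙ                       ∎))
  arc : ∃[ h ] 1 ≤ h × h + h ≡ E → EvenArc n b a
  arc (h , 1≤h , h+h≡E) = h , 1≤h , subst (_≤ n) (sym h+h≡E) (m∸n≤m n D) , (begin
    (b + (h + h)) % n     ≡⟨ cong (λ z → (b + z) % n) h+h≡E ⟩
    (b + E) % n           ≡⟨ cong (λ z → (z + E) % n) (m+[n∸m]≡n (<⇒≤ a<b)) ⟨
    (a + D + E) % n       ≡⟨ cong (_% n) (trans (+-assoc a D E) (cong (a +_) (m+[n∸m]≡n (<⇒≤ D<n)))) ⟩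
    (a + n) % n           ≡⟨ [m+n]%n≡m%n a n ⟩
    a % n                 ≡⟨ m<n⇒m%n≡m (<-trans a<b b<n) ⟩
    a                     ∎)

odd-cycle-even-arc : ∀ {n} .{{_ : NonZero n}} {a b} → parity n ≡ 1ℙ → a < b → b < n → EvenArc n a b ⊎ EvenArc n b a
odd-cycle-even-arc {a = a} {b} odd a<b b<n with parity (b ∸ a) in parity-D
... | 0ℙ = inj₁ (even-arc-inside parity-D a<b b<n)
... | 1ℙ = inj₂ (even-arc-around odd parity-D a<b b<n)

arc⇒equidistant : ∀ {n} .{{_ : NonZero n}} (p q : Fin n) →
                  EvenArc n (toℕ p) (toℕ q) ⊎ EvenArc n (toℕ q) (toℕ p) → Equidistant (Cn n) p q
arc⇒equidistant p q (inj₁ (h , 1≤h , 2h≤n , arc)) = cycle-midpoint p q h 1≤h 2h≤n arc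
arc⇒equidistant p q (inj₂ (h , 1≤h , 2h≤n , arc)) = equidistant-sym (cycle-midpoint q p h 1≤h 2h≤n arc)

odd-cycle-equidistant : ∀ n .{{_ : NonZero n}} → parity n ≡ 1ℙ → EquidistantPairs (Cn n)
odd-cycle-equidistant n odd i j i≢j with <-cmp (toℕ i) (toℕ j)
... | tri< i<j _ _ = arc⇒equidistant i j (odd-cycle-even-arc odd i<j (Fin.toℕ<n j))
... | tri≈ _ i≡j _ = ⊥-elim (i≢j (Fin.toℕ-injective i≡j))
... | tri> _ _ j<i = equidistant-sym (arc⇒equidistant j i (odd-cycle-even-arc odd j<i (Fin.toℕ<n i)))

-- Complete multipartite graphs and wheels

avoid-two : ∀ a b → ∃[ c ] c < 3 × c ≢ a × c ≢ b
avoid-two a b with 0 ≟ a | 0 ≟ b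
... | no 0≢a   | no 0≢b = 0 , s≤s z≤n , 0≢a , 0≢b
... | yes refl | _      with 1 ≟ b
...   | no 1≢b   = 1 , s≤s (s≤s z≤n) , (λ ()) , 1≢b
...   | yes refl = 2 , ≤-refl , (λ ()) , (λ ())
avoid-two a b | no 0≢a | yes refl with 1 ≟ a
...   | no 1≢a   = 1 , s≤s (s≤s z≤n) , 1≢a , (λ ())
...   | yes refl = 2 , ≤-refl , (λ ()) , (λ ())

multipartite-common-neighbours :
  ∀ {n} (part : ℕ → ℕ) → (∀ q → q < 3 → ∃[ c ] c < n × part c ≡ q) →
  CommonNeighbours n (λ a b → not (part a ≡ᵇ part b))
multipartite-common-neighbours part representative a b _ _ _ with avoid-two (part a) (part b)
... | q , q<3 , q≢a , q≢b with representative q q<3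
...   | c , c<n , part-c≡q =
  c , c<n , (λ c≡a → q≢a (trans (sym part-c≡q) (cong part c≡a))) , (λ c≡b → q≢b (trans (sym part-c≡q) (cong part c≡b))) ,
  ≢⇒not≡ᵇ (λ eq → q≢a (trans (sym part-c≡q) eq)) , ≢⇒not≡ᵇ (λ eq → q≢b (trans (sym part-c≡q) eq))

partOf-head : ∀ {p} x (xs : Vec ℕ p) → 1 ≤ x → partOf (x ∷ xs) 0 ≡ 0
partOf-head x xs 1≤x rewrite <⇒<ᵇ≡true 1≤x = refl

partOf-shift : ∀ {p} x (xs : Vec ℕ p) c → partOf (x ∷ xs) (x + c) ≡ suc (partOf xs c)
partOf-shift x xs c rewrite ≥⇒<ᵇ≡false (m≤m+n x c) | m+n∸m≡n x c = refl

part-representative : ∀ {p} (ns : Vec ℕ p) → (∀ i → 1 ≤ lookup ns i) →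
                      ∀ q → q < p → ∃[ c ] c < sumV ns × partOf ns c ≡ q
part-representative (x ∷ xs) nonempty zero    _         =
  0 , ≤-trans (nonempty zero) (m≤m+n x (sumV xs)) , partOf-head x xs (nonempty zero)
part-representative (x ∷ xs) nonempty (suc q) (s≤s q<p) with part-representative xs (nonempty ∘ suc) q q<p
... | c , c<n , part-c≡q = x + c , +-monoʳ-< x c<n , trans (partOf-shift x xs c) (cong suc part-c≡q)

wheelRel : ℕ → ℕ → ℕ → Bool
wheelRel n zero    zero    = false
wheelRel n zero    (suc _) = true
wheelRel n (suc _) zero    = true
wheelRel n (suc a) (suc b) = cycRel (n ∸ 1) a b

Wn-presented : ∀ n → Presents (Wn n) (wheelRel n)
Wn-presented n x y with toℕ x | toℕ y
... | zero  | zero  = refl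
... | zero  | suc _ = refl
... | suc _ | zero  = refl
... | suc _ | suc _ = refl

[1+x]%n≢x : ∀ {N x} .{{_ : NonZero N}} → 2 ≤ N → x < N → suc x % N ≢ x
[1+x]%n≢x {N} {x} 2≤N x<N with suc x <? N
... | yes 1+x<N = λ eq → 1+n≢n (trans (sym (m<n⇒m%n≡m 1+x<N)) eq)
... | no 1+x≮N with ≤-antisym x<N (≮⇒≥ 1+x≮N)
...   | refl = λ eq → <⇒≢ 2≤N (cong suc (sym (trans (sym eq) (n%n≡0 (suc x)))))

rim-neighbour : ∀ n → 4 ≤ n → ∀ b → suc b < n →
                ∃[ c ] c < n × c ≢ 0 × c ≢ suc b × wheelRel n c 0 ≡ true × wheelRel n c (suc b) ≡ true
rim-neighbour (suc N@(suc (suc (suc _)))) (s≤s (s≤s (s≤s (s≤s _)))) b (s≤s b<N) =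
  suc c , s≤s (m%n<n (suc b) N) , (λ ()) , (λ eq → [1+x]%n≢x (s≤s (s≤s z≤n)) b<N (suc-injective eq)) ,
  refl , trans (cycRel-sym N c b) (cycle-step b<N)
  where
  c = suc b % N

wheel-common-neighbours : ∀ n → 4 ≤ n → CommonNeighbours n (wheelRel n)
wheel-common-neighbours n 4≤n zero    zero    _ _ 0≢0 = ⊥-elim (0≢0 refl)
wheel-common-neighbours n 4≤n (suc a) (suc b) _ _ _   = 0 , <-≤-trans (s≤s z≤n) 4≤n , (λ ()) , (λ ()) , refl , refl
wheel-common-neighbours n 4≤n zero    (suc b) _ 1+b<n _ = rim-neighbour n 4≤n b 1+b<n
wheel-common-neighbours n 4≤n (suc a) zero    1+a<n _ _ with rim-neighbour n 4≤n a 1+a<n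
... | c , c<n , c≢0 , c≢1+a , hub , rim = c , c<n , c≢1+a , c≢0 , rim , hub

-- Hypercubes

bitParity : ℕ → ℕ → Parity
bitParity zero    a = 0ℙ
bitParity (suc n) a = parity (a % 2) ℙ.+ bitParity n (a / 2)

hamRel : ℕ → ℕ → ℕ → Bool
hamRel n a b = hamming n a b ≡ᵇ 1

hamming-comm : ∀ n a b → hamming n a b ≡ hamming n b a
hamming-comm zero    a b = refl
hamming-comm (suc n) a b rewrite ≡ᵇ-comm (a % 2) (b % 2) | hamming-comm n (a / 2) (b / 2) = refl

hamming-parity : ∀ n a b → parity (hamming n a b) ≡ bitParity n a ℙ.+ bitParity n b
hamming-parity zero    a b = refl
hamming-parity (suc n) a b = begin
  parity (differs + hamming n a′ b′)                      ≡⟨ ℙ.+-homo-+ differs _ ⟩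
  parity differs ℙ.+ parity (hamming n a′ b′)             ≡⟨ cong₂ ℙ._+_ (bit-parity (m%n<n a 2) (m%n<n b 2))
                                                                          (hamming-parity n a′ b′) ⟩
  (parity (a % 2) ℙ.+ parity (b % 2)) ℙ.+ (bitParity n a′ ℙ.+ bitParity n b′)
                                                          ≡⟨ interchange (parity (a % 2)) _ (bitParity n a′) _ ⟩
  bitParity (suc n) a ℙ.+ bitParity (suc n) b             ∎
  where
  open ≡-Reasoning
  a′ = a / 2
  b′ = b / 2
  differs = if (a % 2) ≡ᵇ (b % 2) then 0 else 1
  bit-parity : ∀ {u v} → u < 2 → v < 2 → parity (if u ≡ᵇ v then 0 else 1) ≡ parity u ℙ.+ parity v
  bit-parity {0} {0} _ _ = refl
  bit-parity {0} {1} _ _ = refl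
  bit-parity {1} {0} _ _ = refl
  bit-parity {1} {1} _ _ = refl
  bit-parity {suc (suc _)} (s≤s (s≤s ())) _
  bit-parity {_} {suc (suc _)} _ (s≤s (s≤s ()))

hamming-flips : ∀ n a b → hamRel n a b ≡ true → bitParity n b ≡ bitParity n a ⁻¹
hamming-flips n a b adjacent = flip (bitParity n a) (trans (sym (hamming-parity n a b))
                                                           (cong parity (≡ᵇ-true⇒≡ {hamming n a b} {1} adjacent)))
  where
  flip : ∀ p {q} → p ℙ.+ q ≡ 1ℙ → q ≡ p ⁻¹
  flip 0ℙ p+q≡1 = p+q≡1
  flip 1ℙ p+q≡1 = sym (ℙ.⁻¹-selfInverse p+q≡1)

private
  [2x]%2≡0 : ∀ x → x * 2 % 2 ≡ 0
  [2x]%2≡0 x = m*n%n≡0 x 2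

  [2x]/2≡x : ∀ x → x * 2 / 2 ≡ x
  [2x]/2≡x x = m*n/n≡m x 2

  [1+2x]%2≡1 : ∀ x → suc (x * 2) % 2 ≡ 1
  [1+2x]%2≡1 x = [m+kn]%n≡m%n 1 x 2

  [1+2x]/2≡x : ∀ x → suc (x * 2) / 2 ≡ x
  [1+2x]/2≡x x = trans (+-distrib-/ 1 (x * 2) (subst (λ r → 1 + r < 2) (sym ([2x]%2≡0 x)) ≤-refl))
                       ([2x]/2≡x x)

  2^-double : ∀ n → 2 ^ suc n ≡ 2 ^ n * 2
  2^-double n = *-comm 2 (2 ^ n)

  double-< : ∀ n {b} → b < 2 ^ n → b * 2 < 2 ^ suc n
  double-< n {b} b<2^n = subst (b * 2 <_) (sym (2^-double n)) (*-monoˡ-< 2 {b} {2 ^ n} b<2^n)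

hamming-self : ∀ n a → hamming n a a ≡ 0
hamming-self zero    a = refl
hamming-self (suc n) a rewrite ≡ᵇ-refl (a % 2) = hamming-self n (a / 2)

hamRel-double : ∀ n x y → hamRel n x y ≡ true → hamRel (suc n) (x * 2) (y * 2) ≡ true
hamRel-double n x y adjacent rewrite [2x]%2≡0 x | [2x]%2≡0 y | [2x]/2≡x x | [2x]/2≡x y = adjacent

hamRel-low-bit : ∀ n x → hamRel (suc n) (suc (x * 2)) (x * 2) ≡ true
hamRel-low-bit n x rewrite [1+2x]%2≡1 x | [2x]%2≡0 x | [1+2x]/2≡x x | [2x]/2≡x x | hamming-self n x = refl

double-walk : ∀ n {x y L} → RelWalk (2 ^ n) (hamRel n) x y L →
              RelWalk (2 ^ suc n) (hamRel (suc n)) (x * 2) (y * 2) L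
double-walk n stop                      = stop
double-walk n (hop {b = b} b<2^n e p) = hop (double-< n b<2^n) (hamRel-double n _ b e) (double-walk n p)

hypercube-reaches-0 : ∀ n a → a < 2 ^ n → ∃[ L ] RelWalk (2 ^ n) (hamRel n) a 0 L
hypercube-reaches-0 zero    zero    _         = 0 , stop
hypercube-reaches-0 zero    (suc a) (s≤s ())
hypercube-reaches-0 (suc n) a       a<2^[1+n] = via-half (hypercube-reaches-0 n (a / 2) a/2<2^n)
  where
  a/2<2^n : a / 2 < 2 ^ n
  a/2<2^n = m<n*o⇒m/o<n (subst (a <_) (2^-double n) a<2^[1+n])
  via-half : ∃[ L ] RelWalk (2 ^ n) (hamRel n) (a / 2) 0 L → ∃[ L ] RelWalk (2 ^ suc n) (hamRel (suc n)) a 0 L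
  via-half (L , p) with a % 2 | m%n<n a 2 | m≡m%n+[m/n]*n a 2
  ... | zero        | _            | a≡ = L , subst (λ z → RelWalk _ _ z 0 L) (sym a≡) (double-walk n p)
  ... | suc zero    | _            | a≡ = suc L , subst (λ z → RelWalk _ _ z 0 (suc L)) (sym a≡)
    (hop (double-< n a/2<2^n) (hamRel-low-bit n (a / 2)) (double-walk n p))
  ... | suc (suc _) | s≤s (s≤s ()) | _

bitParity-low-bit : ∀ n x → bitParity (suc n) (suc (x * 2)) ≡ bitParity (suc n) (x * 2) ⁻¹
bitParity-low-bit n x rewrite [1+2x]%2≡1 x | [1+2x]/2≡x x | [2x]%2≡0 x | [2x]/2≡x x = refl

classSize-alternating : ∀ M col → (∀ x → col (suc (x * 2)) ≡ col (x * 2) ⁻¹) → classSizeBelow (M * 2) col 1ℙ ≡ M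
classSize-alternating zero    col alternating = refl
classSize-alternating (suc M) col alternating rewrite alternating 0 with col 0
... | 0ℙ = cong suc (classSize-alternating M (λ x → col (suc (suc x))) (λ x → alternating (suc x)))
... | 1ℙ = cong suc (classSize-alternating M (λ x → col (suc (suc x))) (λ x → alternating (suc x)))

module Coronas (H : Graph) (a₀ : Fin (order H)) where

  ξ-equidistant : ∀ {G} → EquidistantPairs G → XiIs (G ⊙ H) (order G)
  ξ-equidistant {G} = Corona.ξ-corona-equidistant G H a₀

  ξ-Kn : ∀ n → 3 ≤ n → XiIs (Kn n ⊙ H) n
  ξ-Kn n 3≤n = ξ-equidistant (Presented.equidistant {R = λ a b → not (a ≡ᵇ b)} (λ _ _ → refl)
    (multipartite-common-neighbours (λ a → a) (λ q q<3 → q , <-≤-trans q<3 3≤n , refl)))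

  ξ-Kmulti : ∀ p (ns : Vec ℕ p) → 3 ≤ p → (∀ i → 1 ≤ lookup ns i) → XiIs (Kmulti ns ⊙ H) (sumV ns)
  ξ-Kmulti p ns 3≤p nonempty =
    ξ-equidistant (Presented.equidistant {R = λ a b → not (partOf ns a ≡ᵇ partOf ns b)} (λ _ _ → refl)
    (multipartite-common-neighbours (partOf ns) (λ q q<3 → part-representative ns nonempty q (<-≤-trans q<3 3≤p))))

  ξ-Wn : ∀ n → 4 ≤ n → XiIs (Wn n ⊙ H) n
  ξ-Wn n 4≤n = ξ-equidistant (Presented.equidistant (Wn-presented n) (wheel-common-neighbours n 4≤n))

  ξ-Cn-odd : ∀ n → 3 ≤ n → n % 2 ≡ 1 → XiIs (Cn n ⊙ H) n
  ξ-Cn-odd n@(suc _) _ n%2≡1 = ξ-equidistant (odd-cycle-equidistant n (n%2≡1⇒odd n n%2≡1))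

  ξ-crossing-bipartite :
    ∀ {G} r s → 1 ≤ r → r ≤ s → order G ≡ r + s → Presents G (crossesAt r) → XiIs (G ⊙ H) (r * order H + s)
  ξ-crossing-bipartite r s 1≤r r≤s n≡r+s presents =
    ξ-split-bipartite H a₀ r s 1≤r r≤s n≡r+s presents
      (λ a b → xor-comm (a <ᵇ r) (b <ᵇ r)) (λ a b _ _ → crossing-flips-side r a b)
      (λ a a<r → cong₂ _xor_ (<⇒<ᵇ≡true a<r) (≥⇒<ᵇ≡false (≤-refl {r})))
      (λ b r≤b _ → cong₂ _xor_ (≥⇒<ᵇ≡false r≤b) (<⇒<ᵇ≡true 1≤r))

  ξ-K2 : XiIs (Kn 2 ⊙ H) (order H + 1)
  ξ-K2 = subst (λ z → XiIs (Kn 2 ⊙ H) (z + 1)) (*-identityˡ (order H))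
               (ξ-crossing-bipartite 1 1 ≤-refl ≤-refl refl K2-presented)

  ξ-Krs : ∀ r s → 1 ≤ r → r ≤ s → XiIs (Krs r s ⊙ H) (r * order H + s)
  ξ-Krs r s 1≤r r≤s = ξ-crossing-bipartite r s 1≤r r≤s refl (Krs-presented r s)

  ξ-Bistar : ∀ r s → 1 ≤ r → r ≤ s → XiIs (Bistar r s ⊙ H) (r * order H + s)
  ξ-Bistar r s 1≤r r≤s =
    ξ-split-bipartite H a₀ r s 1≤r r≤s refl (λ _ _ → refl) (bistarRel-sym r)
      (λ a b _ _ adjacent → crossing-flips-side r a b (bistar-crosses r a b adjacent))
      (bistar-to-r r) (λ b r≤b _ → bistar-to-0 r b 1≤r r≤b)

  ξ-Pn : ∀ n → 2 ≤ n → XiIs (Pn n ⊙ H) ((n / 2) * order H + (n + 1) / 2)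
  ξ-Pn n 2≤n = subst₂ (λ r s → XiIs (Pn n ⊙ H) (r * order H + s)) (sym (n/2≡⌊n/2⌋ n)) (sym ([n+1]/2≡⌈n/2⌉ n))
    (ξ-parity-bipartite H a₀ (λ _ _ → refl) unit-step-sym (<-≤-trans (s≤s z≤n) 2≤n)
       (λ a b _ _ → unit-step-flips-parity a b) (λ a _ → unit-step-down a))

  ξ-Cn-even : ∀ n → 3 ≤ n → n % 2 ≡ 0 → XiIs (Cn n ⊙ H) ((n * (order H + 1)) / 2)
  ξ-Cn-even n 3≤n n%2≡0 = subst (XiIs (Cn n ⊙ H)) (even-cycle-size n (order H) even)
    (ξ-parity-bipartite H a₀ {R = cycRel n} (λ _ _ → refl) (cycRel-sym n) (<-≤-trans (s≤s z≤n) 3≤n)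
      (even-cycle-flips n even) (λ a _ → cycRel-down n a))
    where
    even : parity n ≡ 0ℙ
    even = n%2≡0⇒even n n%2≡0

  ξ-Qn : ∀ n → 2 ≤ n → XiIs (Qn n ⊙ H) (2 ^ (n ∸ 1) * (order H + 1))
  ξ-Qn (suc n) _ = subst (XiIs (Qn (suc n) ⊙ H)) size
    (ξ-presented-bipartite H a₀ {R = hamRel (suc n)} (λ _ _ → refl)
      (λ a b → cong (_≡ᵇ 1) (hamming-comm (suc n) a b))
      (bitParity (suc n)) (λ a b _ _ → hamming-flips (suc n) a b) (m^n>0 2 (suc n)) (hypercube-reaches-0 (suc n))
      (subst (λ N → classSizeBelow N (bitParity (suc n)) 1ℙ ≡ half) (sym (2^-double n))
             (classSize-alternating half (bitParity (suc n)) (bitParity-low-bit n)))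
      (cong (half +_) (sym (*-identityˡ half))) ≤-refl)
    where
    half = 2 ^ n
    size : half * order H + half ≡ half * (order H + 1)
    size = sym (trans (*-distribˡ-+ half (order H) 1) (cong (half * order H +_) (*-identityʳ half)))

proposition27 :
    ∀ (H : Graph) → IsSimple H → 1 ≤ order H →
      -- (i)
      ((∀ n → 2 ≤ n → n ≢ 2 → XiIs (Kn n ⊙ H) n)
       × XiIs (Kn 2 ⊙ H) (order H + 1))
      -- (ii)
      × (∀ r s → 1 ≤ r → r ≤ s → XiIs (Krs r s ⊙ H) (r * order H + s))
      -- (iii)
      × (∀ r s → 1 ≤ r → r ≤ s → XiIs (Bistar r s ⊙ H) (r * order H + s))
      -- (iv)
      × (∀ p (ns : Vec ℕ p) → 3 ≤ p → (∀ i → 1 ≤ lookup ns i)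
           → (∀ i j → i ≤ᶠ j → lookup ns i ≤ lookup ns j)
           → XiIs (Kmulti ns ⊙ H) (sumV ns))
      -- (v)
      × (∀ n → 4 ≤ n → XiIs (Wn n ⊙ H) n)
      -- (vi)
      × (∀ n → 2 ≤ n → XiIs (Qn n ⊙ H) (2 ^ (n ∸ 1) * (order H + 1)))
      -- (vii)
      × (∀ n → 2 ≤ n → XiIs (Pn n ⊙ H) ((n / 2) * order H + (n + 1) / 2))
      -- (viii)
      × (∀ n → 3 ≤ n →
           (n % 2 ≡ 1 → XiIs (Cn n ⊙ H) n)
           × (n % 2 ≡ 0 → XiIs (Cn n ⊙ H) ((n * (order H + 1)) / 2)))
proposition27 H _ 1≤m =
  ( (λ n 2≤n n≢2 → ξ-Kn n (≤∧≢⇒< 2≤n (n≢2 ∘ sym))) , ξ-K2)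
  , ξ-Krs
  , ξ-Bistar
  , (λ p ns 3≤p nonempty _ → ξ-Kmulti p ns 3≤p nonempty)
  , ξ-Wn
  , ξ-Qn
  , ξ-Pn
  , (λ n 3≤n → ξ-Cn-odd n 3≤n , ξ-Cn-even n 3≤n)
  where open Coronas H (fromℕ< 1≤m)
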